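{- Let $p$ be a prime, let $\gamma$ be a primitive element of $\mathbb{F}_{p^{2}}$, and for $i=0,1,\dots,p$ let $C_{i}=\gamma^{i}\langle\gamma^{p+1}\rangle$ be the cyclotomic classes of order $p+1$ in $\mathbb{F}_{p^{2}}$. Let $S_{i}=C_{i}\cup\{0\}$ for $i=0,1,\dots,p$. Fix $i',j'\in\{0,1,\dots,p\}$ with $i'\neq j'$. Let $m$ be a positive even integer and define $\Sigma_{l}=l+\{0,2,\dots,m-2\}\subset\mathbb{Z}_{m}$ for $l=0,1$. Then \[S_{i'j'}=(\Sigma_{0}\times S_{i'})\cup(\Sigma_{1}\times S_{j'})\] is a partial geometric difference set in the additive group $\mathbb{Z}_{m}\times\mathbb{F}_{p^{2}}$ with parameters $\left(mp^{2},\,mp;\,\left(\tfrac{m}{2}\right)^{2}p(p+3),\,\tfrac{3}{4}m^{2}p\right)$.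
   Context: Let $G$ be a finite additive Abelian group of order $v$. For $S\subseteq G$ and $z\in G$, let $\delta_{S}(z)=|\{(x,y)\in S\times S: z=x-y\}|$. Let $v>k>2$ be integers. A $k$-subset $S\subseteq G$ is a partial geometric difference set with parameters $(v,k;\alpha,\beta)$ if there are constants $\alpha,\beta$ such that for every $x\in G$, $\sum_{y\in S}\delta_{S}(x-y)=\alpha$ if $x\in S$ and $=\beta$ if $x\notin S$. -}

module Defs where

open import Level using (0ℓ)
open import Data.Bool using (Bool; true; false; _∧_; _∨_)
open import Data.Nat using (ℕ; zero; suc; _+_; _*_; _∸_; _<_; _/_; NonZero)
open import Data.Nat.DivMod using (_mod_)
open import Data.Fin using (Fin; toℕ)
open import Data.Product using (_×_; _,_; ∃-syntax)
open import Data.Nat.ListAction using (sum)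
open import Data.List using (List; length; filterᵇ; map; cartesianProduct; allFin; upTo)
open import Data.Bool.ListAction using (any)
open import Data.Product.Properties using (≡-dec)
import Data.Fin
open import Data.List.Membership.Propositional using (_∈_)
open import Data.List.Relation.Unary.Unique.Propositional using (Unique)
open import Relation.Binary.Definitions using (DecidableEquality)
open import Relation.Binary.PropositionalEquality using (_≡_; _≢_)
open import Relation.Nullary.Decidable using (⌊_⌋)
open import Algebra.Structures using (IsCommutativeRing)

count : {A : Set} → (A → Bool) → List A → ℕ
count P xs = length (filterᵇ P xs)

-- A finite additive group is given by its carrier, decidable equality,
-- subtraction, and a duplicate-free complete enumeration `elems`.
-- Subsets are Boolean predicates.
module PGDS {G : Set} (_≟_ : DecidableEquality G) (_-_ : G → G → G)
            (elems : List G) where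

  δ : (G → Bool) → G → ℕ
  δ S z = count (λ { (x , y) → S x ∧ (S y ∧ ⌊ z ≟ (x - y) ⌋) })
                (cartesianProduct elems elems)

  Δ : (G → Bool) → G → ℕ
  Δ S x = sum (map (λ y → δ S (x - y)) (filterᵇ S elems))

  IsPartialGeometricDifferenceSet : (G → Bool) → (v k α β : ℕ) → Set
  IsPartialGeometricDifferenceSet S v k α β =
      length elems ≡ v × count S elems ≡ k × k < v × 2 < k
    × (∀ x → S x ≡ true → Δ S x ≡ α)
    × (∀ x → S x ≡ false → Δ S x ≡ β)

record FiniteField : Set₁ where
  infixl 7 _·_
  infixl 6 _⊕_
  field
    Carrier  : Set
    _≟_      : DecidableEquality Carrier
    _⊕_ _·_  : Carrier → Carrier → Carrier
    ⊖_       : Carrier → Carrier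
    0# 1#    : Carrier
    isCommutativeRing : IsCommutativeRing _≡_ _⊕_ _·_ ⊖_ 0# 1#
    0≢1      : 0# ≢ 1#
    inverse  : ∀ x → x ≢ 0# → ∃[ y ] x · y ≡ 1#
    elems    : List Carrier
    complete : ∀ x → x ∈ elems
    unique   : Unique elems

  _⊝_ : Carrier → Carrier → Carrier
  x ⊝ y = x ⊕ (⊖ y)

  _^_ : Carrier → ℕ → Carrier
  x ^ zero  = 1#
  x ^ suc n = x · (x ^ n)

  order : ℕ
  order = length elems

  IsPrimitive : Carrier → Set
  IsPrimitive γ = γ ≢ 0# × (∀ x → x ≢ 0# → ∃[ n ] x ≡ γ ^ n)

  -- Every element of the cyclic group ⟨γ^e⟩ is a power
  -- (γ^e)^j with j < order (its order divides order - 1), so the bounded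
  -- search below decides membership in the coset γ^i ⟨γ^e⟩.
  inCoset : (γ : Carrier) (i e : ℕ) → Carrier → Bool
  inCoset γ i e x = any (λ j → ⌊ x ≟ ((γ ^ i) · ((γ ^ e) ^ j)) ⌋) (upTo order)

module Construction (F : FiniteField) (m : ℕ) .{{_ : NonZero m}} where
  open FiniteField F

  G : Set
  G = Fin m × Carrier

  _≟G_ : DecidableEquality G
  _≟G_ = ≡-dec Data.Fin._≟_ _≟_

  _-ₘ_ : Fin m → Fin m → Fin m
  a -ₘ b = (toℕ a + (m ∸ toℕ b)) mod m

  _-G_ : G → G → G
  (a , x) -G (b , y) = (a -ₘ b , x ⊝ y)

  elemsG : List G
  elemsG = cartesianProduct (allFin m) elems

  Σ : ℕ → Fin m → Bool
  Σ l a = any (λ t → ⌊ toℕ a Data.Nat.≟ (l + 2 * t) ⌋) (upTo (m / 2))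

  Sᵢ : (p : ℕ) (γ : Carrier) (i : ℕ) → Carrier → Bool
  Sᵢ p γ i x = ⌊ x ≟ 0# ⌋ ∨ inCoset γ i (p + 1) x

  S₂ : (p : ℕ) (γ : Carrier) (i' j' : ℕ) → G → Bool
  S₂ p γ i' j' (a , x) = (Σ 0 a ∧ Sᵢ p γ i' x) ∨ (Σ 1 a ∧ Sᵢ p γ j' x)

  open PGDS _≟G_ _-G_ elemsG public

module Submission where

-- S₀ = C₀ ∪ {0} is the prime field 𝔽ₚ: by Fermat, 𝔽ₚ* lies in the subgroup ⟨γ^(p+1)⟩ of order p - 1,
-- and both sets have p elements.  Hence every Sᵢ = γⁱ𝔽ₚ is an additive subgroup of order p, and
-- Sᵢ ∩ Sⱼ = {0} for i ≢ j (mod p + 1), so 𝔽 = Sᵢ ⊕ Sⱼ.  Counting decompositions w = u + v, the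
-- convolution 1_X * 1_Y of indicators is p·1_X when X = Y and identically 1 when X, Y are complementary.
-- S_{i'j'} ⊆ ℤ_m × 𝔽 has S_{i'} on the even and S_{j'} on the odd layers, so δ(t, w) is
-- (m/2)·p·(1_{S_{i'}} + 1_{S_{j'}})(w) for even t and m for odd t, and summing over S_{i'j'} gives
-- (m/2)²·p·(p·1_S(t, w) + 3), which is α on S and β off S.

open import Level using (0ℓ)
open import Algebra.Bundles using (AbelianGroup; CommutativeMonoid; CommutativeRing)
open import Algebra.Structures using (IsAbelianGroup)
import Algebra.Definitions.RawMonoid as RawMonoidDefinitions
import Algebra.Properties.AbelianGroup as AbelianGroupProperties
import Algebra.Properties.CommutativeSemigroup as CommutativeSemigroupProperties
import Algebra.Properties.Ring as RingProperties
import Algebra.Properties.Semiring.Mult as SemiringMultProperties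
open import Data.Bool using (Bool; true; false; T; not; _∧_; _∨_; _xor_; if_then_else_)
open import Data.Bool.ListAction using (any; or)
open import Data.Bool.Properties
  using (T-∧; T-∨; not-distribˡ-xor; xor-identityʳ; xor-same; not-involutive; ∨-identityʳ)
open import Data.Empty using (⊥; ⊥-elim)
open import Data.Fin using (toℕ; fromℕ<)
open import Data.Fin.Properties using (toℕ-injective; toℕ<n; toℕ-fromℕ<)
open import Data.List using (List; []; _∷_; map; length; foldr; filterᵇ; cartesianProduct; _++_; upTo; allFin; tabulate)
open import Data.List.Membership.Propositional using (_∈_; lose; find)
open import Data.List.Membership.Propositional.Properties
  using (∈-map⁺; ∈-map⁻; ∈-filter⁺; ∈-filter⁻; ∈-allFin; ∈-upTo⁺; ∈-cartesianProduct⁺)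
open import Data.List.Membership.Propositional.Properties.WithK using (unique∧set⇒bag)
open import Data.List.Properties
  using (map-cong; map-∘; map-++; length-++; length-map; length-tabulate; length-upTo; map-tabulate; tabulate-cong)
open import Data.List.Relation.Binary.BagAndSetEquality using (∼bag⇒↭)
open import Data.List.Relation.Binary.Permutation.Propositional using (_↭_; ↭⇒↭ₛ′)
open import Data.List.Relation.Binary.Permutation.Propositional.Properties using (map⁺)
import Data.List.Relation.Binary.Permutation.Setoid.Properties as PermutationProperties
open import Data.List.Relation.Unary.All using (All; []; _∷_)
import Data.List.Relation.Unary.All as All
open import Data.List.Relation.Unary.AllPairs using ([]; _∷_)
open import Data.List.Relation.Unary.Any using (here; there)
open import Data.List.Relation.Unary.Any.Properties using (any⁺; any⁻)
open import Data.List.Relation.Unary.Unique.Propositional using (Unique)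
open import Data.List.Relation.Unary.Unique.Propositional.Properties using (allFin⁺; cartesianProduct⁺)
  renaming (map⁺ to Unique-map⁺; filter⁺ to Unique-filter⁺)
open import Data.Nat as ℕ
  using (ℕ; zero; suc; _+_; _*_; _∸_; _%_; _/_; _≤_; _<_; z≤n; s≤s; NonZero; >-nonZero; >-nonZero⁻¹)
import Data.Nat.Properties as ℕ
open import Data.Nat.Coprimality using (prime⇒coprime; coprime-Bézout)
open import Data.Nat.DivMod using (_mod_; m≡m%n+[m/n]*n; m%n<n; m<n⇒m%n≡m; [m+kn]%n≡m%n; m∣n⇒o%n%m≡o%m; m*n/n≡m)
open import Data.Nat.Divisibility using (_∣_; divides; *-cancelʳ-∣; %-presˡ-∣; m%n≡0⇒n∣m)
open import Data.Nat.GCD using (module Bézout)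
open import Data.Nat.ListAction using (sum)
open import Data.Nat.ListAction.Properties using (sum-↭; sum-++)
open import Data.Nat.Primality using (Prime; prime⇒nonZero; prime⇒nonTrivial)
open import Data.Nat.Tactic.RingSolver using (solve-∀)
open import Data.Product using (_×_; _,_; ∃-syntax; proj₁; proj₂)
open import Data.Sum using (_⊎_; inj₁; inj₂)
open import Function using (_∘_; Equivalence; mk⇔)
open import Relation.Binary.Definitions using (DecidableEquality; tri<; tri≈; tri>)
open import Relation.Binary.PropositionalEquality
  using (_≡_; _≢_; refl; sym; trans; cong; cong₂; subst; module ≡-Reasoning)
open import Relation.Nullary using (yes; no)
open import Relation.Nullary.Decidable using (⌊_⌋; T?; toWitness; fromWitness; toWitnessFalse; fromWitnessFalse)

open import Defs

-- Indicators

𝟙 : Bool → ℕ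
𝟙 true  = 1
𝟙 false = 0

T-ext : ∀ {a b} → (T a → T b) → (T b → T a) → a ≡ b
T-ext {false} {false} _ _ = refl
T-ext {false} {true}  _ g = ⊥-elim (g _)
T-ext {true}  {false} f _ = ⊥-elim (f _)
T-ext {true}  {true}  _ _ = refl

T⇒𝟙≡1 : ∀ {a} → T a → 𝟙 a ≡ 1
T⇒𝟙≡1 {true} _ = refl

𝟙≡1⇒T : ∀ {a} → 𝟙 a ≡ 1 → T a
𝟙≡1⇒T {true} _ = _

𝟙-injective : ∀ {a b} → 𝟙 a ≡ 𝟙 b → a ≡ b
𝟙-injective {false} {false} _ = refl
𝟙-injective {true}  {true}  _ = refl

𝟙≤1 : ∀ a → 𝟙 a ≤ 1
𝟙≤1 true  = ℕ.≤-refl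
𝟙≤1 false = z≤n

𝟙-mono : ∀ {a b} → (T a → T b) → 𝟙 a ≤ 𝟙 b
𝟙-mono {false}        _ = z≤n
𝟙-mono {true} {true}  _ = ℕ.≤-refl
𝟙-mono {true} {false} h = ⊥-elim (h _)

𝟙-∧ : ∀ a b → 𝟙 (a ∧ b) ≡ 𝟙 a * 𝟙 b
𝟙-∧ true  b = sym (ℕ.+-identityʳ (𝟙 b))
𝟙-∧ false b = refl

𝟙-∨≤ : ∀ a b → 𝟙 (a ∨ b) ≤ 𝟙 a + 𝟙 b
𝟙-∨≤ true  b = s≤s z≤n
𝟙-∨≤ false b = ℕ.≤-refl

𝟙-∨ : ∀ a b → (T a → T b → ⊥) → 𝟙 (a ∨ b) ≡ 𝟙 a + 𝟙 b
𝟙-∨ true  true  disjoint = ⊥-elim (disjoint _ _)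
𝟙-∨ true  false _        = refl
𝟙-∨ false b     _        = refl

-- Sums over lists

∑ : {A : Set} → List A → (A → ℕ) → ℕ
∑ xs f = sum (map f xs)

infix 5 ∑
syntax ∑ xs (λ x → e) = ∑[ x ∈ xs ] e

∑-map : ∀ {A B : Set} (g : A → B) xs (f : B → ℕ) → ∑ (map g xs) f ≡ ∑[ x ∈ xs ] f (g x)
∑-map g xs f = cong sum (sym (map-∘ xs))

module _ {A : Set} where

  ∑-cong : ∀ {f g : A → ℕ} → (∀ x → f x ≡ g x) → ∀ xs → ∑ xs f ≡ ∑ xs g
  ∑-cong f≗g xs = cong sum (map-cong f≗g xs)

  ∑-cong-∈ : ∀ {f g : A → ℕ} xs → (∀ {x} → x ∈ xs → f x ≡ g x) → ∑ xs f ≡ ∑ xs g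
  ∑-cong-∈ []       _   = refl
  ∑-cong-∈ (x ∷ xs) f≗g = cong₂ _+_ (f≗g (here refl)) (∑-cong-∈ xs (f≗g ∘ there))

  ∑-+ : ∀ xs (f g : A → ℕ) → ∑[ x ∈ xs ] f x + g x ≡ ∑ xs f + ∑ xs g
  ∑-+ []       f g = refl
  ∑-+ (x ∷ xs) f g = trans (cong (f x + g x +_) (∑-+ xs f g)) (+-interchange (f x) (g x) (∑ xs f) (∑ xs g))
    where open CommutativeSemigroupProperties ℕ.+-commutativeSemigroup renaming (interchange to +-interchange)

  ∑-*ˡ : ∀ c xs (f : A → ℕ) → ∑[ x ∈ xs ] c * f x ≡ c * ∑ xs f
  ∑-*ˡ c []       f = sym (ℕ.*-zeroʳ c)
  ∑-*ˡ c (x ∷ xs) f = trans (cong (c * f x +_) (∑-*ˡ c xs f)) (sym (ℕ.*-distribˡ-+ c (f x) _))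

  ∑-*ʳ : ∀ c xs (f : A → ℕ) → ∑[ x ∈ xs ] f x * c ≡ ∑ xs f * c
  ∑-*ʳ c xs f = trans (∑-cong (λ x → ℕ.*-comm (f x) c) xs) (trans (∑-*ˡ c xs f) (ℕ.*-comm c (∑ xs f)))

  ∑-const : ∀ c (xs : List A) → ∑[ _ ∈ xs ] c ≡ length xs * c
  ∑-const c []       = refl
  ∑-const c (_ ∷ xs) = cong (c +_) (∑-const c xs)

  ∑-zero : ∀ (xs : List A) → ∑[ _ ∈ xs ] 0 ≡ 0
  ∑-zero xs = trans (∑-const 0 xs) (ℕ.*-zeroʳ (length xs))

  ∑-++ : ∀ xs ys (f : A → ℕ) → ∑ (xs ++ ys) f ≡ ∑ xs f + ∑ ys f
  ∑-++ xs ys f = trans (cong sum (map-++ f xs ys)) (sum-++ (map f xs) (map f ys))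

  ∑-↭ : ∀ {xs ys} (f : A → ℕ) → xs ↭ ys → ∑ xs f ≡ ∑ ys f
  ∑-↭ f xs↭ys = sum-↭ (map⁺ f xs↭ys)

  ∑-mono : ∀ xs {f g : A → ℕ} → (∀ x → f x ≤ g x) → ∑ xs f ≤ ∑ xs g
  ∑-mono []       f≤g = z≤n
  ∑-mono (x ∷ xs) f≤g = ℕ.+-mono-≤ (f≤g x) (∑-mono xs f≤g)

  count≡∑𝟙 : ∀ (P : A → Bool) xs → count P xs ≡ ∑[ x ∈ xs ] 𝟙 (P x)
  count≡∑𝟙 P []       = refl
  count≡∑𝟙 P (x ∷ xs) with P x
  ... | true  = cong suc (count≡∑𝟙 P xs)
  ... | false = count≡∑𝟙 P xs

  ∑-filterᵇ : ∀ (P : A → Bool) xs (f : A → ℕ) → ∑ (filterᵇ P xs) f ≡ ∑[ x ∈ xs ] 𝟙 (P x) * f x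
  ∑-filterᵇ P []       f = refl
  ∑-filterᵇ P (x ∷ xs) f with P x
  ... | true  = cong₂ _+_ (sym (ℕ.+-identityʳ (f x))) (∑-filterᵇ P xs f)
  ... | false = ∑-filterᵇ P xs f

  pointwise-≤∧∑-≥⇒≡ : ∀ {xs} {f g : A → ℕ} → (∀ x → f x ≤ g x) → ∑ xs g ≤ ∑ xs f →
                       ∀ {x} → x ∈ xs → f x ≡ g x
  pointwise-≤∧∑-≥⇒≡ {y ∷ xs} {f} {g} f≤g ∑g≤∑f (here refl) =
    ℕ.≤-antisym (f≤g y) (ℕ.+-cancelʳ-≤ (∑ xs g) (g y) (f y)
      (ℕ.≤-trans ∑g≤∑f (ℕ.+-monoʳ-≤ (f y) (∑-mono xs f≤g))))
  pointwise-≤∧∑-≥⇒≡ {y ∷ xs} {f} {g} f≤g ∑g≤∑f (there x∈xs) =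
    pointwise-≤∧∑-≥⇒≡ f≤g (ℕ.+-cancelˡ-≤ (g y) (∑ xs g) (∑ xs f)
      (ℕ.≤-trans ∑g≤∑f (ℕ.+-monoˡ-≤ (∑ xs f) (f≤g y)))) x∈xs

  ∑𝟙≤1 : ∀ {xs} → Unique xs → (P : A → Bool) → (∀ {x y} → T (P x) → T (P y) → x ≡ y) →
         ∑[ x ∈ xs ] 𝟙 (P x) ≤ 1
  ∑𝟙≤1 {[]}     _            P atMostOne = z≤n
  ∑𝟙≤1 {x ∷ xs} (x∉xs ∷ uxs) P atMostOne with P x in Px
  ... | false = ∑𝟙≤1 uxs P atMostOne
  ... | true  = ℕ.≤-reflexive (cong suc (trans (∑-cong-∈ xs noOther) (∑-zero xs)))
    where
    noOther : ∀ {y} → y ∈ xs → 𝟙 (P y) ≡ 0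
    noOther {y} y∈xs with P y in Py
    ... | false = refl
    ... | true  = ⊥-elim (All.lookup x∉xs y∈xs (atMostOne (subst T (sym Px) _) (subst T (sym Py) _)))

module _ {A B : Set} where

  ∑-cartesianProduct : ∀ xs ys (f : A × B → ℕ) →
                       ∑ (cartesianProduct xs ys) f ≡ ∑[ x ∈ xs ] ∑[ y ∈ ys ] f (x , y)
  ∑-cartesianProduct []       ys f = refl
  ∑-cartesianProduct (x ∷ xs) ys f = begin
    ∑ (map (x ,_) ys ++ cartesianProduct xs ys) f
      ≡⟨ ∑-++ (map (x ,_) ys) _ f ⟩
    ∑ (map (x ,_) ys) f + ∑ (cartesianProduct xs ys) f
      ≡⟨ cong₂ _+_ (∑-map (x ,_) ys f) (∑-cartesianProduct xs ys f) ⟩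
    (∑[ y ∈ ys ] f (x , y)) + (∑[ x ∈ xs ] ∑[ y ∈ ys ] f (x , y))
      ∎
    where open ≡-Reasoning

  length-cartesianProduct : ∀ (xs : List A) (ys : List B) →
                            length (cartesianProduct xs ys) ≡ length xs * length ys
  length-cartesianProduct []       ys = refl
  length-cartesianProduct (x ∷ xs) ys =
    trans (length-++ (map (x ,_) ys)) (cong₂ _+_ (length-map (x ,_) ys) (length-cartesianProduct xs ys))

  ∑-comm : ∀ xs ys (f : A → B → ℕ) → ∑[ x ∈ xs ] ∑[ y ∈ ys ] f x y ≡ ∑[ y ∈ ys ] ∑[ x ∈ xs ] f x y
  ∑-comm []       ys f = sym (∑-zero ys)
  ∑-comm (x ∷ xs) ys f = trans (cong (∑ ys (f x) +_) (∑-comm xs ys f)) (sym (∑-+ ys (f x) _))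

-- Counting in a type with decidable equality

module Counting {A : Set} (_≟_ : DecidableEquality A) where

  𝟙≟-≢ : ∀ {x a} → x ≢ a → 𝟙 ⌊ x ≟ a ⌋ ≡ 0
  𝟙≟-≢ {x} {a} x≢a with x ≟ a
  ... | yes x≡a = ⊥-elim (x≢a x≡a)
  ... | no  _   = refl

  𝟙≟-refl : ∀ a → 𝟙 ⌊ a ≟ a ⌋ ≡ 1
  𝟙≟-refl a with a ≟ a
  ... | yes _   = refl
  ... | no  a≢a = ⊥-elim (a≢a refl)

  ∑-𝟙≟* : ∀ {xs} → Unique xs → ∀ {a} → a ∈ xs → (f : A → ℕ) →
          ∑[ x ∈ xs ] 𝟙 ⌊ x ≟ a ⌋ * f x ≡ f a
  ∑-𝟙≟* {a ∷ xs} (a∉xs ∷ _) (here refl) f =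
    trans (cong₂ _+_ (cong (_* f a) (𝟙≟-refl a)) othersVanish) (trans (ℕ.+-identityʳ _) (ℕ.*-identityˡ (f a)))
    where
    othersVanish : ∑[ x ∈ xs ] 𝟙 ⌊ x ≟ a ⌋ * f x ≡ 0
    othersVanish = trans (∑-cong-∈ xs (λ x∈xs → cong (_* f _) (𝟙≟-≢ (All.lookup a∉xs x∈xs ∘ sym))))
                         (∑-zero xs)
  ∑-𝟙≟* {x ∷ xs} (x∉xs ∷ uxs) (there a∈xs) f
    rewrite 𝟙≟-≢ (All.lookup x∉xs a∈xs) = ∑-𝟙≟* uxs a∈xs f

  ∑-𝟙≟ : ∀ {xs} → Unique xs → ∀ {a} → a ∈ xs → ∑[ x ∈ xs ] 𝟙 ⌊ x ≟ a ⌋ ≡ 1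
  ∑-𝟙≟ {xs} uxs a∈xs =
    trans (∑-cong (λ x → sym (ℕ.*-identityʳ _)) xs) (∑-𝟙≟* uxs a∈xs (λ _ → 1))

  count-≢ : ∀ {xs} → Unique xs → ∀ {a} → a ∈ xs → suc (count (λ x → not ⌊ x ≟ a ⌋) xs) ≡ length xs
  count-≢ {xs} uxs {a} a∈xs = begin
    suc (count (λ x → not ⌊ x ≟ a ⌋) xs)                    ≡⟨ ℕ.+-comm 1 _ ⟩
    count (λ x → not ⌊ x ≟ a ⌋) xs + 1                      ≡⟨ cong₂ _+_ (count≡∑𝟙 _ xs) (sym (∑-𝟙≟ uxs a∈xs)) ⟩
    (∑[ x ∈ xs ] 𝟙 (not ⌊ x ≟ a ⌋)) + (∑[ x ∈ xs ] 𝟙 ⌊ x ≟ a ⌋) ≡⟨ ∑-+ xs _ _ ⟨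
    ∑[ x ∈ xs ] (𝟙 (not ⌊ x ≟ a ⌋) + 𝟙 ⌊ x ≟ a ⌋)             ≡⟨ ∑-cong (λ x → 𝟙-not+𝟙 ⌊ x ≟ a ⌋) xs ⟩
    ∑[ _ ∈ xs ] 1                                             ≡⟨ ∑-const 1 xs ⟩
    length xs * 1                                             ≡⟨ ℕ.*-identityʳ _ ⟩
    length xs                                                 ∎
    where open ≡-Reasoning
          𝟙-not+𝟙 : ∀ b → 𝟙 (not b) + 𝟙 b ≡ 1
          𝟙-not+𝟙 true  = refl
          𝟙-not+𝟙 false = refl

  image : {B : Set} → (B → A) → List B → A → Bool
  image f ks y = any (λ k → ⌊ y ≟ f k ⌋) ks

  module _ {B : Set} {f : B → A} where

    image⁺ : ∀ {k ks} → k ∈ ks → T (image f ks (f k))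
    image⁺ k∈ks = any⁺ _ (lose k∈ks (fromWitness refl))

    image⁻ : ∀ {ks y} → T (image f ks y) → ∃[ k ] k ∈ ks × y ≡ f k
    image⁻ {ks} y∈img with k , k∈ks , y≡fk ← find (any⁻ _ ks y∈img) = k , k∈ks , toWitness y≡fk

    ∑𝟙-image≤ : ∀ {xs} → Unique xs → ∀ ks → ∑[ y ∈ xs ] 𝟙 (image f ks y) ≤ length ks
    ∑𝟙-image≤ {xs} uxs []       = ℕ.≤-reflexive (∑-zero xs)
    ∑𝟙-image≤ {xs} uxs (k ∷ ks) = begin
      ∑[ y ∈ xs ] 𝟙 (⌊ y ≟ f k ⌋ ∨ image f ks y)                       ≤⟨ ∑-mono xs (λ y → 𝟙-∨≤ ⌊ y ≟ f k ⌋ _) ⟩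
      ∑[ y ∈ xs ] (𝟙 ⌊ y ≟ f k ⌋ + 𝟙 (image f ks y))                   ≡⟨ ∑-+ xs _ _ ⟩
      (∑[ y ∈ xs ] 𝟙 ⌊ y ≟ f k ⌋) + (∑[ y ∈ xs ] 𝟙 (image f ks y))     ≤⟨ ℕ.+-mono-≤ atMostOne (∑𝟙-image≤ uxs ks) ⟩
      suc (length ks)                                                   ∎
      where
      open ℕ.≤-Reasoning
      atMostOne = ∑𝟙≤1 uxs _ (λ y≡fk z≡fk → trans (toWitness y≡fk) (sym (toWitness z≡fk)))

    ∑𝟙-image : ∀ {xs} → Unique xs → ∀ {ks} → Unique (map f ks) → (∀ {k} → k ∈ ks → f k ∈ xs) →
               ∑[ y ∈ xs ] 𝟙 (image f ks y) ≡ length ks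
    ∑𝟙-image {xs} uxs {[]}     _           _    = ∑-zero xs
    ∑𝟙-image {xs} uxs {k ∷ ks} (fk∉ ∷ uks) f∈xs = begin
      ∑[ y ∈ xs ] 𝟙 (⌊ y ≟ f k ⌋ ∨ image f ks y)                       ≡⟨ ∑-cong (λ y → 𝟙-∨ _ _ (disjoint y)) xs ⟩
      ∑[ y ∈ xs ] (𝟙 ⌊ y ≟ f k ⌋ + 𝟙 (image f ks y))                   ≡⟨ ∑-+ xs _ _ ⟩
      (∑[ y ∈ xs ] 𝟙 ⌊ y ≟ f k ⌋) + (∑[ y ∈ xs ] 𝟙 (image f ks y))
        ≡⟨ cong₂ _+_ (∑-𝟙≟ uxs (f∈xs (here refl))) (∑𝟙-image uxs uks (f∈xs ∘ there)) ⟩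
      suc (length ks)                                                   ∎
      where
      open ≡-Reasoning
      disjoint : ∀ y → T ⌊ y ≟ f k ⌋ → T (image f ks y) → ⊥
      disjoint y y≡fk y∈img with k′ , k′∈ks , y≡fk′ ← image⁻ y∈img =
        All.lookup fk∉ (∈-map⁺ f k′∈ks) (trans (sym (toWitness y≡fk)) y≡fk′)

  injective⇒map-↭ : ∀ {xs} {h : A → A} → Unique xs → (∀ {x y} → h x ≡ h y → x ≡ y) →
                    (∀ {x} → x ∈ xs → h x ∈ xs) → map h xs ↭ xs
  injective⇒map-↭ {xs} {h} uxs h-injective into =
    ∼bag⇒↭ (unique∧set⇒bag uhxs uxs (mk⇔ into′ onto))
    where
    uhxs : Unique (map h xs)
    uhxs = Unique-map⁺ h-injective uxs
    into′ : ∀ {y} → y ∈ map h xs → y ∈ xs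
    into′ y∈ with x , x∈ , refl ← ∈-map⁻ h y∈ = into x∈
    -- An injection of xs into itself hits all length xs elements of xs.
    hit : ∀ {y} → y ∈ xs → 𝟙 (image h xs y) ≡ 1
    hit = pointwise-≤∧∑-≥⇒≡ (λ y → 𝟙≤1 (image h xs y))
            (ℕ.≤-reflexive (trans (∑-const 1 xs) (trans (ℕ.*-identityʳ _) (sym (∑𝟙-image uxs uhxs into)))))
    onto : ∀ {y} → y ∈ xs → y ∈ map h xs
    onto {y} y∈xs with k , k∈xs , refl ← image⁻ {f = h} {xs} {y} (𝟙≡1⇒T (hit y∈xs)) = ∈-map⁺ h k∈xs

  ∑-reindex : ∀ {xs} → Unique xs → (∀ x → x ∈ xs) → {h : A → A} → (∀ {x y} → h x ≡ h y → x ≡ y) →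
              (f : A → ℕ) → ∑[ x ∈ xs ] f (h x) ≡ ∑ xs f
  ∑-reindex {xs} uxs complete {h} h-injective f =
    trans (sym (∑-map h xs f)) (∑-↭ f (injective⇒map-↭ uxs h-injective (λ _ → complete _)))

-- Finite abelian groups

module FiniteAbelianGroup
  {G : Set} (_≟_ : DecidableEquality G) {_⊕_ : G → G → G} {0# : G} {⊖_ : G → G}
  (isAbelianGroup : IsAbelianGroup _≡_ _⊕_ 0# ⊖_)
  (elems : List G) (complete : ∀ x → x ∈ elems) (unique : Unique elems)
  where

  open Counting _≟_

  private
    abelianGroup : AbelianGroup _ _
    abelianGroup = record { isAbelianGroup = isAbelianGroup }
    open AbelianGroup abelianGroup using (comm; assoc; identityˡ)
    open AbelianGroupProperties abelianGroup
      using (⁻¹-anti-homo‿-; x∙y⁻¹≈ε⇒x≈y; \\-leftDividesʳ; //-rightDividesˡ; ⁻¹-involutive; ∙-cancelʳ)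

  infixl 6 _⊝_
  _⊝_ : G → G → G
  x ⊝ y = x ⊕ (⊖ y)

  [w⊝v]⊝[w⊝u]≡u⊝v : ∀ w u v → (w ⊝ v) ⊝ (w ⊝ u) ≡ u ⊝ v
  [w⊝v]⊝[w⊝u]≡u⊝v w u v = begin
    (w ⊝ v) ⊕ (⊖ (w ⊝ u))         ≡⟨ cong ((w ⊝ v) ⊕_) (⁻¹-anti-homo‿- w u) ⟩
    (w ⊝ v) ⊕ (u ⊝ w)             ≡⟨ comm (w ⊝ v) (u ⊝ w) ⟩
    (u ⊕ (⊖ w)) ⊕ (w ⊕ (⊖ v))     ≡⟨ assoc u (⊖ w) _ ⟩
    u ⊕ ((⊖ w) ⊕ (w ⊕ (⊖ v)))     ≡⟨ cong (u ⊕_) (\\-leftDividesʳ w (⊖ v)) ⟩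
    u ⊝ v                         ∎
    where open ≡-Reasoning

  ⊝-involutive : ∀ x y → x ⊝ (x ⊝ y) ≡ y
  ⊝-involutive x y = trans (cong (x ⊕_) (⁻¹-anti-homo‿- x y)) (trans (comm x (y ⊝ x)) (//-rightDividesˡ x y))

  size : (G → Bool) → ℕ
  size X = ∑[ x ∈ elems ] 𝟙 (X x)

  convolution : (G → Bool) → (G → Bool) → G → ℕ
  convolution X Y w = ∑[ u ∈ elems ] 𝟙 (X u) * 𝟙 (Y (w ⊝ u))

  record IsSubgroup (X : G → Bool) : Set where
    field
      0∈      : T (X 0#)
      ⊝-closed : ∀ {x y} → T (X x) → T (X y) → T (X (x ⊝ y))

    ⊖-closed : ∀ {x} → T (X x) → T (X (⊖ x))
    ⊖-closed x∈ = subst (T ∘ X) (identityˡ _) (⊝-closed 0∈ x∈)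

    ⊕-closed : ∀ {x y} → T (X x) → T (X y) → T (X (x ⊕ y))
    ⊕-closed {x} {y} x∈ y∈ = subst (T ∘ X) (cong (x ⊕_) (⁻¹-involutive y)) (⊝-closed x∈ (⊖-closed y∈))

    ⊝-comm : ∀ x y → X (x ⊝ y) ≡ X (y ⊝ x)
    ⊝-comm x y = T-ext (swap x y) (swap y x)
      where swap : ∀ x y → T (X (x ⊝ y)) → T (X (y ⊝ x))
            swap x y = subst (T ∘ X) (⁻¹-anti-homo‿- x y) ∘ ⊖-closed

    translation-invariant : ∀ {u} w → T (X u) → X (w ⊝ u) ≡ X w
    translation-invariant {u} w u∈ = T-ext (λ w⊝u∈ → subst (T ∘ X) (//-rightDividesˡ u w) (⊕-closed w⊝u∈ u∈))
                              (λ w∈ → ⊝-closed w∈ u∈)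

  IsSubgroup-resp : ∀ {X Y} → (∀ x → X x ≡ Y x) → IsSubgroup X → IsSubgroup Y
  IsSubgroup-resp {X} {Y} X≗Y X≤G = record
    { 0∈      = subst T (X≗Y 0#) 0∈
    ; ⊝-closed = λ x∈Y y∈Y → subst T (X≗Y _) (⊝-closed (subst T (sym (X≗Y _)) x∈Y) (subst T (sym (X≗Y _)) y∈Y))
    }
    where open IsSubgroup X≤G

  ∑-convolution : ∀ X Y → ∑[ w ∈ elems ] convolution X Y w ≡ size X * size Y
  ∑-convolution X Y = begin
    ∑[ w ∈ elems ] ∑[ u ∈ elems ] 𝟙 (X u) * 𝟙 (Y (w ⊝ u))   ≡⟨ ∑-comm elems elems _ ⟩
    ∑[ u ∈ elems ] ∑[ w ∈ elems ] 𝟙 (X u) * 𝟙 (Y (w ⊝ u))   ≡⟨ ∑-cong (λ u → ∑-*ˡ (𝟙 (X u)) elems _) elems ⟩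
    ∑[ u ∈ elems ] 𝟙 (X u) * (∑[ w ∈ elems ] 𝟙 (Y (w ⊝ u))) ≡⟨ ∑-cong (λ u → cong (𝟙 (X u) *_) (translate u)) elems ⟩
    ∑[ u ∈ elems ] 𝟙 (X u) * size Y                        ≡⟨ ∑-*ʳ (size Y) elems _ ⟩
    size X * size Y                                        ∎
    where
    open ≡-Reasoning
    translate : ∀ u → ∑[ w ∈ elems ] 𝟙 (Y (w ⊝ u)) ≡ size Y
    translate u = ∑-reindex unique complete (λ {x} {y} → ∙-cancelʳ (⊖ u) x y) (𝟙 ∘ Y)

  convolution-⊝-comm : ∀ X {Y} → IsSubgroup Y → ∀ w →
                        ∑[ u ∈ elems ] 𝟙 (X u) * 𝟙 (Y (u ⊝ w)) ≡ convolution X Y w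
  convolution-⊝-comm X Y≤G w = ∑-cong (λ u → cong (λ b → 𝟙 (X u) * 𝟙 b) (IsSubgroup.⊝-comm Y≤G u w)) elems

  convolution-self : ∀ {X} → IsSubgroup X → ∀ w → convolution X X w ≡ size X * 𝟙 (X w)
  convolution-self {X} X≤G w = begin
    ∑[ u ∈ elems ] 𝟙 (X u) * 𝟙 (X (w ⊝ u)) ≡⟨ ∑-cong-∈ elems (λ {u} _ → shift u) ⟩
    ∑[ u ∈ elems ] 𝟙 (X u) * 𝟙 (X w)       ≡⟨ ∑-*ʳ (𝟙 (X w)) elems _ ⟩
    size X * 𝟙 (X w)                       ∎
    where
    open ≡-Reasoning
    open IsSubgroup X≤G
    shift : ∀ u → 𝟙 (X u) * 𝟙 (X (w ⊝ u)) ≡ 𝟙 (X u) * 𝟙 (X w)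
    shift u with X u in Xu
    ... | false = refl
    ... | true  = cong (λ b → 𝟙 b + 0) (translation-invariant w (subst T (sym Xu) _))

  module _ {X Y} (X≤G : IsSubgroup X) (Y≤G : IsSubgroup Y)
           (X∩Y≡0 : ∀ {x} → T (X x) → T (Y x) → x ≡ 0#) where

    convolution≤1 : ∀ w → convolution X Y w ≤ 1
    convolution≤1 w = ℕ.≤-trans (ℕ.≤-reflexive (∑-cong (λ u → sym (𝟙-∧ (X u) _)) elems))
                              (∑𝟙≤1 unique (λ u → X u ∧ Y (w ⊝ u)) unique-decomposition)
      where
      unique-decomposition : ∀ {u v} → T (X u ∧ Y (w ⊝ u)) → T (X v ∧ Y (w ⊝ v)) → u ≡ v
      unique-decomposition {u} {v} h h′ = x∙y⁻¹≈ε⇒x≈y u v (X∩Y≡0 (IsSubgroup.⊝-closed X≤G Xu Xv)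
        (subst (T ∘ Y) ([w⊝v]⊝[w⊝u]≡u⊝v w u v) (IsSubgroup.⊝-closed Y≤G Yv Yu)))
        where
        Xu = proj₁ (Equivalence.to T-∧ h)
        Yu = proj₂ (Equivalence.to T-∧ h)
        Xv = proj₁ (Equivalence.to T-∧ h′)
        Yv = proj₂ (Equivalence.to T-∧ h′)

    convolution-complementary : size X * size Y ≡ length elems → ∀ w → convolution X Y w ≡ 1
    convolution-complementary |X||Y|≡|G| w = pointwise-≤∧∑-≥⇒≡ convolution≤1
      (ℕ.≤-reflexive (trans (∑-const 1 elems) (trans (ℕ.*-identityʳ _)
        (trans (sym |X||Y|≡|G|) (sym (∑-convolution X Y)))))) (complete w)

-- Products in a commutative monoid

module _ (M : CommutativeMonoid 0ℓ 0ℓ) where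
  open CommutativeMonoid M
    using (Carrier; _≈_; _∙_; ε; identityˡ; ∙-congˡ; setoid; isEquivalence; isCommutativeMonoid;
           rawMonoid; commutativeSemigroup)
  open RawMonoidDefinitions rawMonoid using () renaming (_×_ to _times_)
  open CommutativeSemigroupProperties commutativeSemigroup using (interchange)
  open import Relation.Binary.Reasoning.Setoid setoid

  ∏ : List Carrier → Carrier
  ∏ = foldr _∙_ ε

  ∏-map-∙ : ∀ x L → ∏ (map (x ∙_) L) ≈ (length L times x) ∙ ∏ L
  ∏-map-∙ x []      = begin ε ≈⟨ identityˡ ε ⟨ ε ∙ ε ∎
  ∏-map-∙ x (y ∷ L) = begin
    (x ∙ y) ∙ ∏ (map (x ∙_) L)            ≈⟨ ∙-congˡ (∏-map-∙ x L) ⟩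
    (x ∙ y) ∙ ((length L times x) ∙ ∏ L)  ≈⟨ interchange x y _ _ ⟩
    (x ∙ (length L times x)) ∙ (y ∙ ∏ L)  ∎

  ∏-translation-invariant : ∀ {x L} → map (x ∙_) L ↭ L → (length L times x) ∙ ∏ L ≈ ∏ L
  ∏-translation-invariant {x} {L} x∙L↭L = begin
    (length L times x) ∙ ∏ L  ≈⟨ ∏-map-∙ x L ⟨
    ∏ (map (x ∙_) L)          ≈⟨ PermutationProperties.foldr-commMonoid setoid isCommutativeMonoid
                                   (↭⇒↭ₛ′ isEquivalence x∙L↭L) ⟩
    ∏ L                       ∎

-- Finite fields

module FiniteFieldProperties (F : FiniteField) where
  open FiniteField F

  ring : CommutativeRing 0ℓ 0ℓ
  ring = record { isCommutativeRing = isCommutativeRing }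

  private
    module R = CommutativeRing ring
    module RP = RingProperties R.ring
  open SemiringMultProperties R.semiring using (×-homo-+; ×1-homo-*) renaming (_×_ to _times_)
  open Counting _≟_ public
  open FiniteAbelianGroup _≟_ R.+-isAbelianGroup elems complete unique public hiding (_⊝_)

  1≢0 : 1# ≢ 0#
  1≢0 = 0≢1 ∘ sym

  x·y≡0⇒x≡0∨y≡0 : ∀ {x y} → x · y ≡ 0# → x ≡ 0# ⊎ y ≡ 0#
  x·y≡0⇒x≡0∨y≡0 {x} {y} xy≡0 with x ≟ 0#
  ... | yes x≡0 = inj₁ x≡0
  ... | no  x≢0 with x⁻¹ , xx⁻¹≡1 ← inverse x x≢0 = inj₂ (begin
    y              ≡⟨ R.*-identityˡ y ⟨
    1# · y         ≡⟨ cong (_· y) (trans (sym xx⁻¹≡1) (R.*-comm x x⁻¹)) ⟩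
    (x⁻¹ · x) · y  ≡⟨ R.*-assoc x⁻¹ x y ⟩
    x⁻¹ · (x · y)  ≡⟨ cong (x⁻¹ ·_) xy≡0 ⟩
    x⁻¹ · 0#       ≡⟨ R.zeroʳ x⁻¹ ⟩
    0#             ∎)
    where open ≡-Reasoning

  ·-≢0 : ∀ {x y} → x ≢ 0# → y ≢ 0# → x · y ≢ 0#
  ·-≢0 x≢0 y≢0 xy≡0 with x·y≡0⇒x≡0∨y≡0 xy≡0
  ... | inj₁ x≡0 = x≢0 x≡0
  ... | inj₂ y≡0 = y≢0 y≡0

  ·-cancelˡ : ∀ {a x y} → a ≢ 0# → a · x ≡ a · y → x ≡ y
  ·-cancelˡ {a} {x} {y} a≢0 ax≡ay
    with x·y≡0⇒x≡0∨y≡0 (trans (RP.x[y-z]≈xy-xz a x y) (RP.x≈y⇒x∙y⁻¹≈ε ax≡ay))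
  ... | inj₁ a≡0   = ⊥-elim (a≢0 a≡0)
  ... | inj₂ x-y≡0 = RP.x∙y⁻¹≈ε⇒x≈y x y x-y≡0

  ^-distribˡ-+-· : ∀ x a b → x ^ (a + b) ≡ x ^ a · x ^ b
  ^-distribˡ-+-· x zero    b = sym (R.*-identityˡ (x ^ b))
  ^-distribˡ-+-· x (suc a) b = trans (cong (x ·_) (^-distribˡ-+-· x a b)) (sym (R.*-assoc x _ _))

  ^-distribʳ-· : ∀ x y n → (x · y) ^ n ≡ x ^ n · y ^ n
  ^-distribʳ-· x y zero    = sym (R.*-identityˡ 1#)
  ^-distribʳ-· x y (suc n) = trans (cong ((x · y) ·_) (^-distribʳ-· x y n))
                                   (CommutativeSemigroupProperties.interchange R.*-commutativeSemigroup x y _ _)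

  1^n≡1 : ∀ n → 1# ^ n ≡ 1#
  1^n≡1 zero    = refl
  1^n≡1 (suc n) = trans (R.*-identityˡ (1# ^ n)) (1^n≡1 n)

  ^-*-assoc : ∀ x a b → (x ^ a) ^ b ≡ x ^ (a * b)
  ^-*-assoc x zero    b = 1^n≡1 b
  ^-*-assoc x (suc a) b = begin
    (x · x ^ a) ^ b      ≡⟨ ^-distribʳ-· x (x ^ a) b ⟩
    x ^ b · (x ^ a) ^ b  ≡⟨ cong (x ^ b ·_) (^-*-assoc x a b) ⟩
    x ^ b · x ^ (a * b) ≡⟨ ^-distribˡ-+-· x b (a * b) ⟨
    x ^ (b + a * b)   ∎
    where open ≡-Reasoning

  ^-≢0 : ∀ {x} n → x ≢ 0# → x ^ n ≢ 0#
  ^-≢0 zero    x≢0 = 1≢0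
  ^-≢0 (suc n) x≢0 = ·-≢0 x≢0 (^-≢0 n x≢0)

  ·-cancelʳ : ∀ {a x y} → a ≢ 0# → x · a ≡ y · a → x ≡ y
  ·-cancelʳ {a} {x} {y} a≢0 xa≡ya = ·-cancelˡ a≢0 (trans (R.*-comm a x) (trans xa≡ya (R.*-comm y a)))

  ∏-≢0 : ∀ {L} → All (_≢ 0#) L → ∏ R.*-commutativeMonoid L ≢ 0#
  ∏-≢0 []           = 1≢0
  ∏-≢0 (x≢0 ∷ L≢0) = ·-≢0 x≢0 (∏-≢0 L≢0)

  ι : ℕ → Carrier
  ι n = n times 1#

  ι-+ : ∀ a b → ι (a + b) ≡ ι a ⊕ ι b
  ι-+ a b = ×-homo-+ 1# a b

  ι-* : ∀ a b → ι (a * b) ≡ ι a · ι b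
  ι-* = ×1-homo-*

  ι-order≡0 : ι order ≡ 0#
  ι-order≡0 = RP.+-cancelʳ (∏⁺ elems) (ι order) 0# (begin
    ι order ⊕ ∏⁺ elems   ≡⟨ ∏-translation-invariant R.+-commutativeMonoid 1⊕elems↭elems ⟩
    ∏⁺ elems             ≡⟨ R.+-identityˡ (∏⁺ elems) ⟨
    0# ⊕ ∏⁺ elems        ∎)
    where
    open ≡-Reasoning
    ∏⁺ = ∏ R.+-commutativeMonoid
    1⊕elems↭elems : map (1# ⊕_) elems ↭ elems
    1⊕elems↭elems = injective⇒map-↭ unique (RP.+-cancelˡ 1# _ _) (λ _ → complete _)

  scale : Carrier → (Carrier → Bool) → Carrier → Bool
  scale c X y = X (c · y)

  scale-isSubgroup : ∀ {X} c → IsSubgroup X → IsSubgroup (scale c X)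
  scale-isSubgroup {X} c X≤G = record
    { 0∈      = subst (T ∘ X) (sym (R.zeroʳ c)) 0∈
    ; ⊝-closed = λ {x} {y} cx∈X cy∈X → subst (T ∘ X) (sym (RP.x[y-z]≈xy-xz c x y)) (⊝-closed cx∈X cy∈X)
    }
    where open IsSubgroup X≤G

  size-scale : ∀ X {c} → c ≢ 0# → size (scale c X) ≡ size X
  size-scale X c≢0 = ∑-reindex unique complete (·-cancelˡ c≢0) (𝟙 ∘ X)

  nonzeros : List Carrier → List Carrier
  nonzeros = filterᵇ (λ x → not ⌊ x ≟ 0# ⌋)

  ∈-nonzeros⁺ : ∀ {x xs} → x ∈ xs → x ≢ 0# → x ∈ nonzeros xs
  ∈-nonzeros⁺ x∈xs x≢0 = ∈-filter⁺ (T? ∘ (λ x → not ⌊ x ≟ 0# ⌋)) x∈xs (fromWitnessFalse x≢0)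

  ∈-nonzeros⁻ : ∀ {x} xs → x ∈ nonzeros xs → x ∈ xs × x ≢ 0#
  ∈-nonzeros⁻ xs x∈ with x∈xs , x≢0 ← ∈-filter⁻ (T? ∘ (λ x → not ⌊ x ≟ 0# ⌋)) {xs = xs} x∈ =
    x∈xs , toWitnessFalse x≢0

  lagrange : ∀ {x xs} → Unique xs → x ≢ 0# → (∀ {y} → y ∈ xs → x · y ∈ xs) →
             x ^ length (nonzeros xs) ≡ 1#
  lagrange {x} {xs} uxs x≢0 into = ·-cancelʳ (∏-≢0 (All.tabulate (proj₂ ∘ ∈-nonzeros⁻ xs))) (begin
    x ^ length L · ∏* L                ≡⟨ cong (_· ∏* L) (^-as-times (length L)) ⟩
    (length L times* x) · ∏* L         ≡⟨ ∏-translation-invariant R.*-commutativeMonoid x·L↭L ⟩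
    ∏* L                               ≡⟨ R.*-identityˡ (∏* L) ⟨
    1# · ∏* L                          ∎)
    where
    open ≡-Reasoning
    open RawMonoidDefinitions R.*-rawMonoid using () renaming (_×_ to _times*_)
    L = nonzeros xs
    ∏* = ∏ R.*-commutativeMonoid
    ^-as-times : ∀ n → x ^ n ≡ n times* x
    ^-as-times zero    = refl
    ^-as-times (suc n) = cong (x ·_) (^-as-times n)
    x·L↭L : map (x ·_) L ↭ L
    x·L↭L = injective⇒map-↭ (Unique-filter⁺ _ uxs) (·-cancelˡ x≢0)
      λ y∈L → let y∈xs , y≢0 = ∈-nonzeros⁻ xs y∈L in ∈-nonzeros⁺ (into y∈xs) (·-≢0 x≢0 y≢0)

  x^[order∸1]≡1 : ∀ {x} → x ≢ 0# → x ^ (order ∸ 1) ≡ 1#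
  x^[order∸1]≡1 x≢0 = subst (λ n → _ ^ n ≡ 1#) (cong (_∸ 1) (count-≢ unique (complete 0#)))
                             (lagrange unique x≢0 (λ _ → complete _))

  ^-mod : ∀ x {d} .{{_ : NonZero d}} → x ^ d ≡ 1# → ∀ n → x ^ n ≡ x ^ (n % d)
  ^-mod x {d} x^d≡1 n = begin
    x ^ n                              ≡⟨ cong (x ^_) n≡n%d+d*[n/d] ⟩
    x ^ (n % d + d * (n / d))          ≡⟨ ^-distribˡ-+-· x (n % d) _ ⟩
    x ^ (n % d) · x ^ (d * (n / d))    ≡⟨ cong (x ^ (n % d) ·_) (sym (^-*-assoc x d (n / d))) ⟩
    x ^ (n % d) · (x ^ d) ^ (n / d)    ≡⟨ cong (λ y → x ^ (n % d) · y ^ (n / d)) x^d≡1 ⟩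
    x ^ (n % d) · 1# ^ (n / d)         ≡⟨ cong (x ^ (n % d) ·_) (1^n≡1 (n / d)) ⟩
    x ^ (n % d) · 1#                   ≡⟨ R.*-identityʳ _ ⟩
    x ^ (n % d)                        ∎
    where
    open ≡-Reasoning
    n≡n%d+d*[n/d] = trans (m≡m%n+[m/n]*n n d) (cong (n % d +_) (ℕ.*-comm (n / d) d))

-- The prime field of a field with p² elements

module PrimeSquareField (F : FiniteField) {p : ℕ} (p-prime : Prime p)
                        (order≡p*p : FiniteField.order F ≡ p * p) where
  open FiniteField F
  open FiniteFieldProperties F
  private
    module R = CommutativeRing ring
    module RP = RingProperties R.ring
    instance
      p≢0 : NonZero p
      p≢0 = prime⇒nonZero p-prime

  ι-p≡0 : ι p ≡ 0#
  ι-p≡0 with x·y≡0⇒x≡0∨y≡0 (trans (sym (ι-* p p)) (trans (cong ι (sym order≡p*p)) ι-order≡0))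
  ... | inj₁ ι-p≡0 = ι-p≡0
  ... | inj₂ ι-p≡0 = ι-p≡0

  ι-*≡0 : ∀ {a} → ι a ≡ 0# → ∀ k → ι (k * a) ≡ 0#
  ι-*≡0 {a} ιa≡0 k = trans (ι-* k a) (trans (cong (ι k ·_) ιa≡0) (R.zeroʳ (ι k)))

  ι-*p≡0 : ∀ k → ι (k * p) ≡ 0#
  ι-*p≡0 = ι-*≡0 ι-p≡0

  ι-mod : ∀ n → ι n ≡ ι (n % p)
  ι-mod n = begin
    ι n                          ≡⟨ cong ι (m≡m%n+[m/n]*n n p) ⟩
    ι (n % p + n / p * p)        ≡⟨ ι-+ (n % p) _ ⟩
    ι (n % p) ⊕ ι (n / p * p)    ≡⟨ cong (ι (n % p) ⊕_) (ι-*p≡0 (n / p)) ⟩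
    ι (n % p) ⊕ 0#               ≡⟨ R.+-identityʳ _ ⟩
    ι (n % p)                    ∎
    where open ≡-Reasoning

  1+u≡v∧ιu≡0⇒ιv≢0 : ∀ {u v} → 1 + u ≡ v → ι u ≡ 0# → ι v ≢ 0#
  1+u≡v∧ιu≡0⇒ιv≢0 {u} 1+u≡v ιu≡0 ιv≡0 =
    1≢0 (trans (sym (R.+-identityʳ 1#)) (trans (cong (1# ⊕_) (sym ιu≡0)) (trans (cong ι 1+u≡v) ιv≡0)))

  ι-≢0 : ∀ {a} → 0 < a → a < p → ι a ≢ 0#
  ι-≢0 {a@(suc _)} _ a<p ιa≡0 with coprime-Bézout (prime⇒coprime p-prime a<p)
  ... | Bézout.+- x y 1+ya≡xp = 1+u≡v∧ιu≡0⇒ιv≢0 1+ya≡xp (ι-*≡0 ιa≡0 y) (ι-*p≡0 x)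
  ... | Bézout.-+ x y 1+xp≡ya = 1+u≡v∧ιu≡0⇒ιv≢0 1+xp≡ya (ι-*p≡0 x) (ι-*≡0 ιa≡0 y)

  ι-<-injective : ∀ {a b} → a < b → b < p → ι a ≢ ι b
  ι-<-injective {a} {b} a<b b<p ιa≡ιb =
    ι-≢0 (ℕ.m<n⇒0<n∸m a<b) (ℕ.≤-<-trans (ℕ.m∸n≤m b a) b<p)
      (RP.+-cancelˡ (ι a) _ _ (begin
        ι a ⊕ ι (b ∸ a)  ≡⟨ ι-+ a (b ∸ a) ⟨
        ι (a + (b ∸ a))  ≡⟨ cong ι (ℕ.m+[n∸m]≡n (ℕ.<⇒≤ a<b)) ⟩
        ι b              ≡⟨ ιa≡ιb ⟨
        ι a              ≡⟨ R.+-identityʳ (ι a) ⟨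
        ι a ⊕ 0#         ∎))
    where open ≡-Reasoning

  ι-injective : ∀ {a b} → a < p → b < p → ι a ≡ ι b → a ≡ b
  ι-injective {a} {b} a<p b<p ιa≡ιb with ℕ.<-cmp a b
  ... | tri≈ _ a≡b _ = a≡b
  ... | tri< a<b _ _ = ⊥-elim (ι-<-injective a<b b<p ιa≡ιb)
  ... | tri> _ _ b<a = ⊥-elim (ι-<-injective b<a a<p (sym ιa≡ιb))

  ι-∸ : ∀ {b} → b ≤ p → ι (p ∸ b) ≡ ⊖ ι b
  ι-∸ {b} b≤p = RP.+-inverseʳ-unique (ι b) (ι (p ∸ b))
    (trans (sym (ι-+ b (p ∸ b))) (trans (cong ι (ℕ.m+[n∸m]≡n b≤p)) ι-p≡0))

  𝔽ₚ-elems : List Carrier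
  𝔽ₚ-elems = map (ι ∘ toℕ) (allFin p)

  𝔽ₚ-unique : Unique 𝔽ₚ-elems
  𝔽ₚ-unique = Unique-map⁺ (λ {i} {j} → toℕ-injective ∘ ι-injective (toℕ<n i) (toℕ<n j)) (allFin⁺ p)

  ι∈𝔽ₚ : ∀ n → ι n ∈ 𝔽ₚ-elems
  ι∈𝔽ₚ n = subst (_∈ 𝔽ₚ-elems) (trans (cong ι (toℕ-fromℕ< n%p<p)) (sym (ι-mod n)))
                 (∈-map⁺ (ι ∘ toℕ) (∈-allFin (fromℕ< n%p<p)))
    where n%p<p = m%n<n n p

  ∈𝔽ₚ⁻ : ∀ {x} → x ∈ 𝔽ₚ-elems → ∃[ a ] a < p × x ≡ ι a
  ∈𝔽ₚ⁻ x∈ with k , _ , refl ← ∈-map⁻ (ι ∘ toℕ) x∈ = toℕ k , toℕ<n k , refl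

  ·-closed-𝔽ₚ : ∀ {x y} → x ∈ 𝔽ₚ-elems → y ∈ 𝔽ₚ-elems → x · y ∈ 𝔽ₚ-elems
  ·-closed-𝔽ₚ x∈ y∈ with a , _ , refl ← ∈𝔽ₚ⁻ x∈ | b , _ , refl ← ∈𝔽ₚ⁻ y∈ =
    subst (_∈ 𝔽ₚ-elems) (ι-* a b) (ι∈𝔽ₚ (a * b))

  ⊝-closed-𝔽ₚ : ∀ {x y} → x ∈ 𝔽ₚ-elems → y ∈ 𝔽ₚ-elems → x ⊝ y ∈ 𝔽ₚ-elems
  ⊝-closed-𝔽ₚ x∈ y∈ with a , _ , refl ← ∈𝔽ₚ⁻ x∈ | b , b<p , refl ← ∈𝔽ₚ⁻ y∈ =
    subst (_∈ 𝔽ₚ-elems) (trans (ι-+ a (p ∸ b)) (cong (ι a ⊕_) (ι-∸ (ℕ.<⇒≤ b<p)))) (ι∈𝔽ₚ (a + (p ∸ b)))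

  fermat : ∀ {x} → x ∈ 𝔽ₚ-elems → x ≢ 0# → x ^ (p ∸ 1) ≡ 1#
  fermat x∈ x≢0 = subst (λ n → _ ^ n ≡ 1#) |𝔽ₚ∖0|≡p∸1 (lagrange 𝔽ₚ-unique x≢0 (·-closed-𝔽ₚ x∈))
    where
    |𝔽ₚ∖0|≡p∸1 : length (nonzeros 𝔽ₚ-elems) ≡ p ∸ 1
    |𝔽ₚ∖0|≡p∸1 = cong (_∸ 1) (trans (count-≢ 𝔽ₚ-unique (ι∈𝔽ₚ 0))
                                   (trans (length-map _ (allFin p)) (length-tabulate {n = p} (λ i → i))))

  𝔽ₚ : Carrier → Bool
  𝔽ₚ = image (ι ∘ toℕ) (allFin p)

  𝔽ₚ⁺ : ∀ {x} → x ∈ 𝔽ₚ-elems → T (𝔽ₚ x)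
  𝔽ₚ⁺ x∈ with k , _ , refl ← ∈-map⁻ (ι ∘ toℕ) x∈ = image⁺ (∈-allFin k)

  𝔽ₚ⁻ : ∀ {x} → T (𝔽ₚ x) → x ∈ 𝔽ₚ-elems
  𝔽ₚ⁻ {x} x∈𝔽ₚ with k , k∈ , refl ← image⁻ {f = ι ∘ toℕ} {allFin p} {x} x∈𝔽ₚ = ∈-map⁺ (ι ∘ toℕ) k∈

  𝔽ₚ-isSubgroup : IsSubgroup 𝔽ₚ
  𝔽ₚ-isSubgroup = record
    { 0∈      = 𝔽ₚ⁺ (ι∈𝔽ₚ 0)
    ; ⊝-closed = λ x∈ y∈ → 𝔽ₚ⁺ (⊝-closed-𝔽ₚ (𝔽ₚ⁻ x∈) (𝔽ₚ⁻ y∈))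
    }

  size-𝔽ₚ : size 𝔽ₚ ≡ p
  size-𝔽ₚ = trans (∑𝟙-image unique 𝔽ₚ-unique (λ _ → complete _)) (length-tabulate {n = p} (λ i → i))

-- Cyclotomic classes of order p + 1

n*n∸1≡[n+1]*[n∸1] : ∀ n → n * n ∸ 1 ≡ (n + 1) * (n ∸ 1)
n*n∸1≡[n+1]*[n∸1] zero    = refl
n*n∸1≡[n+1]*[n∸1] (suc k) = k+k*[1+k]≡[2+k]*k k
  where k+k*[1+k]≡[2+k]*k : ∀ k → k + k * suc k ≡ (suc k + 1) * k
        k+k*[1+k]≡[2+k]*k = solve-∀

module CyclotomicClasses (F : FiniteField) {p : ℕ} (p-prime : Prime p)
                         (order≡p*p : FiniteField.order F ≡ p * p)
                         {γ : FiniteField.Carrier F} (γ-primitive : FiniteField.IsPrimitive F γ) where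
  open FiniteField F
  open FiniteFieldProperties F
  open PrimeSquareField F p-prime order≡p*p
  private
    module R = CommutativeRing ring

  N : ℕ
  N = order ∸ 1

  N≡[p+1]*[p∸1] : N ≡ (p + 1) * (p ∸ 1)
  N≡[p+1]*[p∸1] = trans (cong (_∸ 1) order≡p*p) (n*n∸1≡[n+1]*[n∸1] p)

  1<p : 1 < p
  1<p = ℕ.nonTrivial⇒n>1 p {{prime⇒nonTrivial p-prime}}

  private
    instance
      p+1≢0 : NonZero (p + 1)
      p+1≢0 = subst NonZero (ℕ.+-comm 1 p) _
      p∸1≢0 : NonZero (p ∸ 1)
      p∸1≢0 = >-nonZero (ℕ.m<n⇒0<n∸m 1<p)
      N≢0 : NonZero N
      N≢0 = subst NonZero (sym N≡[p+1]*[p∸1]) (ℕ.m*n≢0 (p + 1) (p ∸ 1))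

  p+1∣N : p + 1 ∣ N
  p+1∣N = divides (p ∸ 1) (trans N≡[p+1]*[p∸1] (ℕ.*-comm (p + 1) (p ∸ 1)))

  γ≢0 : γ ≢ 0#
  γ≢0 = proj₁ γ-primitive

  γ^N≡1 : γ ^ N ≡ 1#
  γ^N≡1 = x^[order∸1]≡1 γ≢0

  |nonzeros|≡N : length (nonzeros elems) ≡ N
  |nonzeros|≡N = cong (_∸ 1) (count-≢ unique (complete 0#))

  -- Every nonzero element is a power γ ^ (n % d), so all N of them lie in γ ^ [0, d).
  γ^d≡1⇒N≤d : ∀ {d} → 0 < d → γ ^ d ≡ 1# → N ≤ d
  γ^d≡1⇒N≤d {d} 0<d γ^d≡1 = begin
    N                                                      ≡⟨ |nonzeros|≡N ⟨
    length (nonzeros elems)                                ≡⟨ ℕ.*-identityʳ _ ⟨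
    length (nonzeros elems) * 1                            ≡⟨ ∑-const 1 (nonzeros elems) ⟨
    ∑[ y ∈ nonzeros elems ] 1                              ≡⟨ ∑-cong-∈ (nonzeros elems) (sym ∘ power) ⟩
    ∑[ y ∈ nonzeros elems ] 𝟙 (image (γ ^_) (upTo d) y)    ≤⟨ ∑𝟙-image≤ (Unique-filter⁺ _ unique) (upTo d) ⟩
    length (upTo d)                                        ≡⟨ length-upTo d ⟩
    d                                                      ∎
    where
    open ℕ.≤-Reasoning
    instance _ = >-nonZero 0<d
    power : ∀ {y} → y ∈ nonzeros elems → 𝟙 (image (γ ^_) (upTo d) y) ≡ 1
    power y∈ with n , refl ← proj₂ γ-primitive _ (proj₂ (∈-nonzeros⁻ elems y∈)) =
      T⇒𝟙≡1 (subst (T ∘ image (γ ^_) (upTo d)) (sym (^-mod γ γ^d≡1 n)) (image⁺ (∈-upTo⁺ (m%n<n n d))))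

  γ^-<-injective : ∀ {a b} → a < b → b < N → γ ^ a ≢ γ ^ b
  γ^-<-injective {a} {b} a<b b<N γ^a≡γ^b =
    ℕ.<-irrefl refl (ℕ.<-≤-trans b<N (ℕ.≤-trans (γ^d≡1⇒N≤d (ℕ.m<n⇒0<n∸m a<b) γ^[b∸a]≡1) (ℕ.m∸n≤m b a)))
    where
    γ^[b∸a]≡1 : γ ^ (b ∸ a) ≡ 1#
    γ^[b∸a]≡1 = ·-cancelˡ (^-≢0 a γ≢0) (begin
      γ ^ a · γ ^ (b ∸ a)  ≡⟨ ^-distribˡ-+-· γ a (b ∸ a) ⟨
      γ ^ (a + (b ∸ a))    ≡⟨ cong (γ ^_) (ℕ.m+[n∸m]≡n (ℕ.<⇒≤ a<b)) ⟩
      γ ^ b                ≡⟨ γ^a≡γ^b ⟨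
      γ ^ a                ≡⟨ R.*-identityʳ (γ ^ a) ⟨
      γ ^ a · 1#           ∎)
      where open ≡-Reasoning

  γ^-injective : ∀ {a b} → a < N → b < N → γ ^ a ≡ γ ^ b → a ≡ b
  γ^-injective {a} {b} a<N b<N γ^a≡γ^b with ℕ.<-cmp a b
  ... | tri≈ _ a≡b _ = a≡b
  ... | tri< a<b _ _ = ⊥-elim (γ^-<-injective a<b b<N γ^a≡γ^b)
  ... | tri> _ _ b<a = ⊥-elim (γ^-<-injective b<a a<N (sym γ^a≡γ^b))

  γ^≡γ^⇒%N≡ : ∀ {a b} → γ ^ a ≡ γ ^ b → a % N ≡ b % N
  γ^≡γ^⇒%N≡ {a} {b} γ^a≡γ^b = γ^-injective (m%n<n a N) (m%n<n b N)
    (trans (sym (^-mod γ γ^N≡1 a)) (trans γ^a≡γ^b (^-mod γ γ^N≡1 b)))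

  g : Carrier
  g = γ ^ (p + 1)

  g^[p∸1]≡1 : g ^ (p ∸ 1) ≡ 1#
  g^[p∸1]≡1 = trans (^-*-assoc γ (p + 1) (p ∸ 1)) (trans (cong (γ ^_) (sym N≡[p+1]*[p∸1])) γ^N≡1)

  γ^i·g^j≡γ^[i+j*[p+1]] : ∀ i j → γ ^ i · g ^ j ≡ γ ^ (i + j * (p + 1))
  γ^i·g^j≡γ^[i+j*[p+1]] i j = trans (cong (γ ^ i ·_) (trans (^-*-assoc γ (p + 1) j) (cong (γ ^_) (ℕ.*-comm (p + 1) j))))
                                    (sym (^-distribˡ-+-· γ i _))

  coset⁺ : ∀ {i j} → j < order → T (inCoset γ i (p + 1) (γ ^ i · g ^ j))
  coset⁺ j<order = image⁺ (∈-upTo⁺ j<order)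

  coset⁻ : ∀ {i x} → T (inCoset γ i (p + 1) x) → ∃[ j ] x ≡ γ ^ i · g ^ j
  coset⁻ {i} {x} x∈ with j , _ , x≡ ← image⁻ {f = λ j → γ ^ i · g ^ j} {upTo order} {x} x∈ = j , x≡

  S : ℕ → Carrier → Bool
  S i x = ⌊ x ≟ 0# ⌋ ∨ inCoset γ i (p + 1) x

  C₀⊆g^<[p∸1] : ∀ {x} → T (inCoset γ 0 (p + 1) x) → T (image (g ^_) (upTo (p ∸ 1)) x)
  C₀⊆g^<[p∸1] x∈C₀ with j , refl ← coset⁻ {0} x∈C₀ =
    subst (T ∘ image (g ^_) (upTo (p ∸ 1))) (trans (sym (^-mod g g^[p∸1]≡1 j)) (sym (R.*-identityˡ _)))
          (image⁺ (∈-upTo⁺ (m%n<n j (p ∸ 1))))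

  size-S₀≤p : size (S 0) ≤ p
  size-S₀≤p = begin
    ∑[ x ∈ elems ] 𝟙 (⌊ x ≟ 0# ⌋ ∨ inCoset γ 0 (p + 1) x)
      ≤⟨ ∑-mono elems (λ x → ℕ.≤-trans (𝟙-∨≤ ⌊ x ≟ 0# ⌋ _) (ℕ.+-monoʳ-≤ (𝟙 ⌊ x ≟ 0# ⌋) (𝟙-mono C₀⊆g^<[p∸1]))) ⟩
    ∑[ x ∈ elems ] (𝟙 ⌊ x ≟ 0# ⌋ + 𝟙 (image (g ^_) (upTo (p ∸ 1)) x))
      ≡⟨ ∑-+ elems _ _ ⟩
    (∑[ x ∈ elems ] 𝟙 ⌊ x ≟ 0# ⌋) + (∑[ x ∈ elems ] 𝟙 (image (g ^_) (upTo (p ∸ 1)) x))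
      ≤⟨ ℕ.+-mono-≤ (ℕ.≤-reflexive (∑-𝟙≟ unique (complete 0#))) (∑𝟙-image≤ unique (upTo (p ∸ 1))) ⟩
    1 + length (upTo (p ∸ 1))
      ≡⟨ cong (1 +_) (length-upTo (p ∸ 1)) ⟩
    1 + (p ∸ 1)
      ≡⟨ ℕ.m+[n∸m]≡n (ℕ.<⇒≤ 1<p) ⟩
    p ∎
    where open ℕ.≤-Reasoning

  p+1∣⇒γ^∈C₀ : ∀ {n} → p + 1 ∣ n → T (inCoset γ 0 (p + 1) (γ ^ n))
  p+1∣⇒γ^∈C₀ {n} p+1∣n with divides j n%N≡j*[p+1] ← %-presˡ-∣ {n = N} p+1∣n p+1∣N =
    subst (T ∘ inCoset γ 0 (p + 1)) γ^n≡g^j (coset⁺ {0} j<order)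
    where
    γ^n≡g^j : γ ^ 0 · g ^ j ≡ γ ^ n
    γ^n≡g^j = trans (γ^i·g^j≡γ^[i+j*[p+1]] 0 j) (sym (trans (^-mod γ γ^N≡1 n) (cong (γ ^_) n%N≡j*[p+1])))
    j<order : j < order
    j<order = ℕ.≤-<-trans (ℕ.m≤m*n j (p + 1))
                (ℕ.<-≤-trans (subst (_< N) n%N≡j*[p+1] (m%n<n n N)) (ℕ.m∸n≤m order 1))

  -- Fermat's little theorem puts 𝔽ₚ* inside the subgroup of order p - 1 of ⟨γ⟩, which is C₀.
  𝔽ₚ⊆S₀ : ∀ {x} → T (𝔽ₚ x) → T (S 0 x)
  𝔽ₚ⊆S₀ {x} x∈𝔽ₚ with x ≟ 0#
  ... | yes _   = _
  ... | no  x≢0 with n , refl ← proj₂ γ-primitive x x≢0 = p+1∣⇒γ^∈C₀ p+1∣n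
    where
    N∣n*[p∸1] : N ∣ n * (p ∸ 1)
    N∣n*[p∸1] = m%n≡0⇒n∣m _ N (trans (γ^≡γ^⇒%N≡ (trans (sym (^-*-assoc γ n (p ∸ 1))) (fermat (𝔽ₚ⁻ x∈𝔽ₚ) x≢0)))
                                      (m<n⇒m%n≡m (ℕ.>-nonZero⁻¹ N)))
    p+1∣n : p + 1 ∣ n
    p+1∣n = *-cancelʳ-∣ (p ∸ 1) (subst (_∣ n * (p ∸ 1)) N≡[p+1]*[p∸1] N∣n*[p∸1])

  S₀≡𝔽ₚ : ∀ x → S 0 x ≡ 𝔽ₚ x
  S₀≡𝔽ₚ x = 𝟙-injective (sym (pointwise-≤∧∑-≥⇒≡ (λ _ → 𝟙-mono 𝔽ₚ⊆S₀)
                                 (ℕ.≤-trans size-S₀≤p (ℕ.≤-reflexive (sym size-𝔽ₚ))) (complete x)))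

  γ⁻¹ : Carrier
  γ⁻¹ = proj₁ (inverse γ γ≢0)

  γ^i·γ⁻¹^i≡1 : ∀ i → γ ^ i · γ⁻¹ ^ i ≡ 1#
  γ^i·γ⁻¹^i≡1 i = trans (sym (^-distribʳ-· γ γ⁻¹ i)) (trans (cong (_^ i) (proj₂ (inverse γ γ≢0))) (1^n≡1 i))

  γ⁻¹^i≢0 : ∀ i → γ⁻¹ ^ i ≢ 0#
  γ⁻¹^i≢0 i γ⁻¹^i≡0 = 1≢0 (trans (sym (γ^i·γ⁻¹^i≡1 i)) (trans (cong (γ ^ i ·_) γ⁻¹^i≡0) (R.zeroʳ _)))

  S≡scale : ∀ i x → S i x ≡ scale (γ⁻¹ ^ i) (S 0) x
  S≡scale i x = cong₂ _∨_ (T-ext (λ x≡0 → fromWitness (trans (cong (c ·_) (toWitness x≡0)) (R.zeroʳ c)))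
                                 (λ cx≡0 → fromWitness (trans unscale
                                             (trans (cong (γ ^ i ·_) (toWitness cx≡0)) (R.zeroʳ _)))))
                          (cong or (map-cong (λ j → T-ext (λ e → fromWitness (to (toWitness e)))
                                                          (λ e → fromWitness (from (toWitness e))))
                                             (upTo order)))
    where
    c = γ⁻¹ ^ i
    unscale : x ≡ γ ^ i · (c · x)
    unscale = begin
      x                  ≡⟨ R.*-identityˡ x ⟨
      1# · x             ≡⟨ cong (_· x) (γ^i·γ⁻¹^i≡1 i) ⟨
      (γ ^ i · c) · x    ≡⟨ R.*-assoc (γ ^ i) c x ⟩
      γ ^ i · (c · x)    ∎
      where open ≡-Reasoning
    to : ∀ {y} → x ≡ γ ^ i · y → c · x ≡ 1# · y
    to {y} refl = trans (sym (R.*-assoc c (γ ^ i) y)) (cong (_· y) (trans (R.*-comm c (γ ^ i)) (γ^i·γ⁻¹^i≡1 i)))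
    from : ∀ {y} → c · x ≡ 1# · y → x ≡ γ ^ i · y
    from {y} cx≡y = trans unscale (cong (γ ^ i ·_) (trans cx≡y (R.*-identityˡ y)))

  S-isSubgroup : ∀ i → IsSubgroup (S i)
  S-isSubgroup i = IsSubgroup-resp (sym ∘ S≡scale i)
    (scale-isSubgroup (γ⁻¹ ^ i) (IsSubgroup-resp (sym ∘ S₀≡𝔽ₚ) 𝔽ₚ-isSubgroup))

  size-S : ∀ i → size (S i) ≡ p
  size-S i = begin
    size (S i)                     ≡⟨ ∑-cong (cong 𝟙 ∘ S≡scale i) elems ⟩
    size (scale (γ⁻¹ ^ i) (S 0))   ≡⟨ size-scale (S 0) (γ⁻¹^i≢0 i) ⟩
    size (S 0)                     ≡⟨ ∑-cong (cong 𝟙 ∘ S₀≡𝔽ₚ) elems ⟩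
    size 𝔽ₚ                        ≡⟨ size-𝔽ₚ ⟩
    p                              ∎
    where open ≡-Reasoning

  -- Cᵢ ∩ Cⱼ ≠ ∅ forces i ≡ j (mod p + 1), as p + 1 divides the order N of γ.
  S-disjoint : ∀ {i j} → i ≤ p → j ≤ p → i ≢ j → ∀ {x} → T (S i x) → T (S j x) → x ≡ 0#
  S-disjoint {i} {j} i≤p j≤p i≢j {x} x∈Sᵢ x∈Sⱼ
    with Equivalence.to T-∨ x∈Sᵢ | Equivalence.to T-∨ x∈Sⱼ
  ... | inj₁ x≡0 | _         = toWitness x≡0
  ... | inj₂ _   | inj₁ x≡0  = toWitness x≡0
  ... | inj₂ x∈Cᵢ | inj₂ x∈Cⱼ
    with a , x≡γ^i·g^a ← coset⁻ {i} x∈Cᵢ | b , x≡γ^j·g^b ← coset⁻ {j} x∈Cⱼ =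
    ⊥-elim (i≢j (begin
      i                                    ≡⟨ residue i≤p a ⟨
      (i + a * (p + 1)) % N % (p + 1)       ≡⟨ cong (_% (p + 1)) (γ^≡γ^⇒%N≡ γ^≡γ^) ⟩
      (j + b * (p + 1)) % N % (p + 1)       ≡⟨ residue j≤p b ⟩
      j                                    ∎))
    where
    open ≡-Reasoning
    γ^≡γ^ : γ ^ (i + a * (p + 1)) ≡ γ ^ (j + b * (p + 1))
    γ^≡γ^ = trans (sym (γ^i·g^j≡γ^[i+j*[p+1]] i a))
                  (trans (sym x≡γ^i·g^a) (trans x≡γ^j·g^b (γ^i·g^j≡γ^[i+j*[p+1]] j b)))
    residue : ∀ {k} → k ≤ p → ∀ c → (k + c * (p + 1)) % N % (p + 1) ≡ k
    residue {k} k≤p c = begin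
      (k + c * (p + 1)) % N % (p + 1)  ≡⟨ m∣n⇒o%n%m≡o%m (p + 1) N _ p+1∣N ⟩
      (k + c * (p + 1)) % (p + 1)      ≡⟨ [m+kn]%n≡m%n k c (p + 1) ⟩
      k % (p + 1)                      ≡⟨ m<n⇒m%n≡m (ℕ.≤-<-trans k≤p (ℕ.m<m+n p (s≤s z≤n))) ⟩
      k                                ∎

-- Parity

odd : ℕ → Bool
odd zero    = false
odd (suc n) = not (odd n)

odd-+ : ∀ m n → odd (m + n) ≡ odd m xor odd n
odd-+ zero    n = refl
odd-+ (suc m) n = trans (cong not (odd-+ m n)) (not-distribˡ-xor (odd m) (odd n))

odd-* : ∀ k {m} → odd m ≡ false → odd (k * m) ≡ false
odd-* zero    _          = refl
odd-* (suc k) {m} m-even = trans (odd-+ m (k * m)) (cong₂ _xor_ m-even (odd-* k m-even))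

odd-𝟙+2* : ∀ b t → odd (𝟙 b + 2 * t) ≡ b
odd-𝟙+2* b t = trans (odd-+ (𝟙 b) (2 * t)) (trans (cong₂ _xor_ (odd-𝟙 b) odd-2*t) (xor-identityʳ b))
  where
  odd-𝟙 : ∀ b → odd (𝟙 b) ≡ b
  odd-𝟙 false = refl
  odd-𝟙 true  = refl
  odd-2*t : odd (2 * t) ≡ false
  odd-2*t = trans (cong odd (ℕ.*-comm 2 t)) (odd-* t refl)

halve : ∀ x → ∃[ t ] x ≡ 𝟙 (odd x) + 2 * t
halve zero = 0 , refl
halve (suc x) with odd x | halve x
... | false | t , x≡2t   = t , cong suc x≡2t
... | true  | t , x≡1+2t = suc t , trans (cong suc x≡1+2t) (sym (ℕ.*-suc 2 t))

private
  not-xor-self : ∀ b → T (not b xor b)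
  not-xor-self false = _
  not-xor-self true  = _

  not-xor⇒≡ : ∀ b c → T (not b xor c) → c ≡ b
  not-xor⇒≡ false false _ = refl
  not-xor⇒≡ true  true  _ = refl

module ℕ-Counting = Counting ℕ._≟_

image-𝟙+2*-parity : ∀ b {n x} → x < n * 2 → ℕ-Counting.image (λ t → 𝟙 b + 2 * t) (upTo n) x ≡ not b xor odd x
image-𝟙+2*-parity b {n} {x} x<2n = T-ext to from
  where
  to : T (ℕ-Counting.image (λ t → 𝟙 b + 2 * t) (upTo n) x) → T (not b xor odd x)
  to x∈ with t , _ , refl ← ℕ-Counting.image⁻ {f = λ t → 𝟙 b + 2 * t} {upTo n} {x} x∈ =
    subst (λ c → T (not b xor c)) (sym (odd-𝟙+2* b t)) (not-xor-self b)
  from : T (not b xor odd x) → T (ℕ-Counting.image (λ t → 𝟙 b + 2 * t) (upTo n) x)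
  from parity with t , x≡ ← halve x rewrite not-xor⇒≡ b (odd x) parity =
    subst (T ∘ ℕ-Counting.image (λ t → 𝟙 b + 2 * t) (upTo n)) (sym x≡) (ℕ-Counting.image⁺ (∈-upTo⁺ t<n))
    where
    t<n : t < n
    t<n = ℕ.*-cancelˡ-< 2 t n (ℕ.≤-<-trans (ℕ.m≤n+m (2 * t) (𝟙 b))
            (subst (_< 2 * n) x≡ (subst (x <_) (ℕ.*-comm n 2) x<2n)))

sum-tabulate-2-periodic : ∀ n (f : ℕ → ℕ) → (∀ x → f (2 + x) ≡ f x) →
                          sum (tabulate {n = n * 2} (f ∘ toℕ)) ≡ n * (f 0 + f 1)
sum-tabulate-2-periodic zero    f periodic = refl
sum-tabulate-2-periodic (suc n) f periodic = begin
  f 0 + (f 1 + sum (tabulate {n = n * 2} (f ∘ (2 +_) ∘ toℕ)))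
    ≡⟨ cong (λ xs → f 0 + (f 1 + sum xs)) (tabulate-cong {n = n * 2} (periodic ∘ toℕ)) ⟩
  f 0 + (f 1 + sum (tabulate {n = n * 2} (f ∘ toℕ)))
    ≡⟨ cong (λ s → f 0 + (f 1 + s)) (sum-tabulate-2-periodic n f periodic) ⟩
  f 0 + (f 1 + n * (f 0 + f 1))
    ≡⟨ ℕ.+-assoc (f 0) (f 1) _ ⟨
  f 0 + f 1 + n * (f 0 + f 1)
    ∎
  where open ≡-Reasoning

∑-allFin-parity : ∀ n (h : Bool → ℕ) → ∑[ a ∈ allFin (n * 2) ] h (odd (toℕ a)) ≡ n * (h false + h true)
∑-allFin-parity n h = trans (cong sum (map-tabulate {n = n * 2} (λ i → i) (h ∘ odd ∘ toℕ)))
  (sum-tabulate-2-periodic n (h ∘ odd) (λ x → cong h (not-involutive (odd x))))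

-- The construction

-- Imported only here: in the field modules above, _^_ is the power of FiniteField.
open import Data.Nat using (_^_)

module PGDSProperties {G : Set} (_≟_ : DecidableEquality G) (_-_ : G → G → G) (elems : List G)
                      (unique : Unique elems) (complete : ∀ x → x ∈ elems)
                      (-‿involutive : ∀ x y → x - (x - y) ≡ y) where
  open PGDS _≟_ _-_ elems
  open Counting _≟_

  δ≡∑ : ∀ S z → δ S z ≡ ∑[ x ∈ elems ] 𝟙 (S x) * 𝟙 (S (x - z))
  δ≡∑ S z = begin
    δ S z                                                       ≡⟨ count≡∑𝟙 _ (cartesianProduct elems elems) ⟩
    _                                                           ≡⟨ ∑-cartesianProduct elems elems _ ⟩
    ∑[ x ∈ elems ] ∑[ y ∈ elems ] 𝟙 (S x ∧ (S y ∧ ⌊ z ≟ (x - y) ⌋)) ≡⟨ ∑-cong partners elems ⟩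
    ∑[ x ∈ elems ] 𝟙 (S x) * 𝟙 (S (x - z))                       ∎
    where
    open ≡-Reasoning
    swap : ∀ {x u v} → u ≡ x - v → v ≡ x - u
    swap {x} {u} {v} u≡x-v = trans (sym (-‿involutive x v)) (cong (x -_) (sym u≡x-v))
    partners : ∀ x → ∑[ y ∈ elems ] 𝟙 (S x ∧ (S y ∧ ⌊ z ≟ (x - y) ⌋)) ≡ 𝟙 (S x) * 𝟙 (S (x - z))
    partners x = begin
      ∑[ y ∈ elems ] 𝟙 (S x ∧ (S y ∧ ⌊ z ≟ (x - y) ⌋))
        ≡⟨ ∑-cong (λ y → trans (𝟙-∧ (S x) _) (cong (𝟙 (S x) *_) (trans (𝟙-∧ (S y) _) (ℕ.*-comm (𝟙 (S y)) _)))) elems ⟩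
      ∑[ y ∈ elems ] 𝟙 (S x) * (𝟙 ⌊ z ≟ (x - y) ⌋ * 𝟙 (S y))
        ≡⟨ ∑-cong (λ y → cong (λ b → 𝟙 (S x) * (𝟙 b * 𝟙 (S y)))
                              (T-ext {⌊ z ≟ (x - y) ⌋} {⌊ y ≟ (x - z) ⌋} (fromWitness ∘ swap ∘ toWitness)
                                                                        (fromWitness ∘ swap ∘ toWitness))) elems ⟩
      ∑[ y ∈ elems ] 𝟙 (S x) * (𝟙 ⌊ y ≟ (x - z) ⌋ * 𝟙 (S y))
        ≡⟨ ∑-*ˡ (𝟙 (S x)) elems _ ⟩
      𝟙 (S x) * (∑[ y ∈ elems ] 𝟙 ⌊ y ≟ (x - z) ⌋ * 𝟙 (S y))
        ≡⟨ cong (𝟙 (S x) *_) (∑-𝟙≟* unique (complete (x - z)) (𝟙 ∘ S)) ⟩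
      𝟙 (S x) * 𝟙 (S (x - z))
        ∎

module ConstructionProperties (F : FiniteField) (n : ℕ) .{{_ : NonZero (n * 2)}} where
  open FiniteField F hiding (_^_)
  open FiniteFieldProperties F
  open Construction F (n * 2)

  private
    m : ℕ
    m = n * 2

  odd-%m : ∀ x → odd (x % m) ≡ odd x
  odd-%m x = sym (begin
    odd x                                 ≡⟨ cong odd (m≡m%n+[m/n]*n x m) ⟩
    odd (x % m + x / m * m)               ≡⟨ odd-+ (x % m) _ ⟩
    odd (x % m) xor odd (x / m * m)       ≡⟨ cong (odd (x % m) xor_) (odd-* (x / m) {m} (odd-* n refl)) ⟩
    odd (x % m) xor false                 ≡⟨ xor-identityʳ _ ⟩
    odd (x % m)                           ∎)
    where open ≡-Reasoning

  odd-∸ : ∀ {b} → b ≤ m → odd (m ∸ b) ≡ odd b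
  odd-∸ {b} b≤m = xor≡false⇒≡ (trans (sym (odd-+ (m ∸ b) b)) (trans (cong odd (ℕ.m∸n+n≡m b≤m)) (odd-* n refl)))
    where xor≡false⇒≡ : ∀ {c d} → c xor d ≡ false → c ≡ d
          xor≡false⇒≡ {false} {false} _ = refl
          xor≡false⇒≡ {true}  {true}  _ = refl

  odd-ₘ : ∀ a b → odd (toℕ (a -ₘ b)) ≡ odd (toℕ a) xor odd (toℕ b)
  odd-ₘ a b = begin
    odd (toℕ (a -ₘ b))                      ≡⟨ cong odd (toℕ-fromℕ< (m%n<n (toℕ a + (m ∸ toℕ b)) m)) ⟩
    odd ((toℕ a + (m ∸ toℕ b)) % m)         ≡⟨ odd-%m _ ⟩
    odd (toℕ a + (m ∸ toℕ b))               ≡⟨ odd-+ (toℕ a) _ ⟩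
    odd (toℕ a) xor odd (m ∸ toℕ b)         ≡⟨ cong (odd (toℕ a) xor_) (odd-∸ (ℕ.<⇒≤ (toℕ<n b))) ⟩
    odd (toℕ a) xor odd (toℕ b)             ∎
    where open ≡-Reasoning

  -- With D := a - b we have A + (m ∸ D) + D = A + m = D + ⌊T/m⌋m + B, where T = A + (m ∸ B).
  -ₘ-involutive : ∀ a b → a -ₘ (a -ₘ b) ≡ b
  -ₘ-involutive a b = toℕ-injective (begin
    toℕ (a -ₘ (a -ₘ b))        ≡⟨ toℕ-fromℕ< _ ⟩
    (A + (m ∸ D)) % m          ≡⟨ cong (_% m) A+[m∸D]≡B+k*m ⟩
    (B + k * m) % m            ≡⟨ [m+kn]%n≡m%n B k m ⟩
    B % m                      ≡⟨ m<n⇒m%n≡m (toℕ<n b) ⟩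
    B                          ∎)
    where
    open ≡-Reasoning
    A = toℕ a
    B = toℕ b
    D = toℕ (a -ₘ b)
    k = (A + (m ∸ B)) / m
    D+k*m≡A+[m∸B] : D + k * m ≡ A + (m ∸ B)
    D+k*m≡A+[m∸B] = trans (cong (_+ k * m) (toℕ-fromℕ< _)) (sym (m≡m%n+[m/n]*n (A + (m ∸ B)) m))
    A+[m∸D]≡B+k*m : A + (m ∸ D) ≡ B + k * m
    A+[m∸D]≡B+k*m = ℕ.+-cancelʳ-≡ D _ _ (begin
      A + (m ∸ D) + D        ≡⟨ ℕ.+-assoc A (m ∸ D) D ⟩
      A + (m ∸ D + D)        ≡⟨ cong (A +_) (ℕ.m∸n+n≡m (ℕ.<⇒≤ (toℕ<n (a -ₘ b)))) ⟩
      A + m                  ≡⟨ cong (A +_) (ℕ.m∸n+n≡m (ℕ.<⇒≤ (toℕ<n b))) ⟨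
      A + (m ∸ B + B)        ≡⟨ ℕ.+-assoc A (m ∸ B) B ⟨
      A + (m ∸ B) + B        ≡⟨ cong (_+ B) D+k*m≡A+[m∸B] ⟨
      D + k * m + B          ≡⟨ ℕ.+-comm (D + k * m) B ⟩
      B + (D + k * m)        ≡⟨ cong (B +_) (ℕ.+-comm D (k * m)) ⟩
      B + (k * m + D)        ≡⟨ ℕ.+-assoc B (k * m) D ⟨
      B + k * m + D          ∎)

  -G-involutive : ∀ x y → x -G (x -G y) ≡ y
  -G-involutive (a , x) (b , y) = cong₂ _,_ (-ₘ-involutive a b) (⊝-involutive x y)

  elemsG-unique : Unique elemsG
  elemsG-unique = cartesianProduct⁺ (allFin⁺ m) unique

  elemsG-complete : ∀ x → x ∈ elemsG
  elemsG-complete (a , x) = ∈-cartesianProduct⁺ (∈-allFin a) (complete x)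

  open PGDSProperties _≟G_ _-G_ elemsG elemsG-unique elemsG-complete -G-involutive public

  Σ-parity : ∀ b a → Σ (𝟙 b) a ≡ not b xor odd (toℕ a)
  Σ-parity b a = image-𝟙+2*-parity b {m / 2} (subst (toℕ a <_) (cong (_* 2) (sym (m*n/n≡m n 2))) (toℕ<n a))

  layered-by-parity : ∀ (A B : Carrier → Bool) a x → (Σ 0 a ∧ A x) ∨ (Σ 1 a ∧ B x) ≡ (if odd (toℕ a) then B else A) x
  layered-by-parity A B a x rewrite Σ-parity false a | Σ-parity true a with odd (toℕ a)
  ... | false = ∨-identityʳ (A x)
  ... | true  = refl

  module Layered {p : ℕ} (1<p : 1 < p) (order≡p*p : order ≡ p * p)
                 {A B : Carrier → Bool} (A≤F : IsSubgroup A) (B≤F : IsSubgroup B)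
                 (size-A : size A ≡ p) (size-B : size B ≡ p)
                 (A∩B≡0 : ∀ {x} → T (A x) → T (B x) → x ≡ 0#)
                 (S : G → Bool) (S-layered : ∀ a x → S (a , x) ≡ (if odd (toℕ a) then B else A) x) where

    private
      instance
        n≢0 : NonZero n
        n≢0 = ℕ.m*n≢0⇒m≢0 n
        p≢0 : NonZero p
        p≢0 = >-nonZero (ℕ.<-trans (s≤s z≤n) 1<p)

      part : Bool → Carrier → Bool
      part e = if e then B else A

      part-isSubgroup : ∀ e → IsSubgroup (part e)
      part-isSubgroup false = A≤F
      part-isSubgroup true  = B≤F

      size-part : ∀ e → size (part e) ≡ p
      size-part false = size-A
      size-part true  = size-B

      |part|*|part|≡|F| : ∀ e e′ → size (part e) * size (part e′) ≡ length elems
      |part|*|part|≡|F| e e′ = trans (cong₂ _*_ (size-part e) (size-part e′)) (sym order≡p*p)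

    convolution-same : ∀ e w → convolution (part e) (part e) w ≡ p * 𝟙 (part e w)
    convolution-same e w = trans (convolution-self (part-isSubgroup e) w) (cong (_* 𝟙 (part e w)) (size-part e))

    convolution-other : ∀ e w → convolution (part e) (part (not e)) w ≡ 1
    convolution-other false = convolution-complementary A≤F B≤F A∩B≡0 (|part|*|part|≡|F| false true)
    convolution-other true  = convolution-complementary B≤F A≤F (λ x∈B x∈A → A∩B≡0 x∈A x∈B)
                                                        (|part|*|part|≡|F| true false)

    δ/n : Bool → Carrier → ℕ
    δ/n false w = p * 𝟙 (A w) + p * 𝟙 (B w)
    δ/n true  w = 2

    convolution-column : ∀ o w → convolution A (part o) w + convolution B (part (not o)) w ≡ δ/n o w
    convolution-column false w = cong₂ _+_ (convolution-same false w) (convolution-same true w)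
    convolution-column true  w = cong₂ _+_ (convolution-other false w) (convolution-other true w)

    convolution-row : ∀ o w → convolution (part o) A w + convolution (part o) B w ≡ p * 𝟙 (part o w) + 1
    convolution-row false w = cong₂ _+_ (convolution-same false w) (convolution-other false w)
    convolution-row true  w = trans (ℕ.+-comm (convolution B A w) _)
                                    (cong₂ _+_ (convolution-same true w) (convolution-other true w))

    δ-S : ∀ t w → δ S (t , w) ≡ n * δ/n (odd (toℕ t)) w
    δ-S t w = begin
      δ S (t , w)
        ≡⟨ δ≡∑ S (t , w) ⟩
      ∑[ x ∈ elemsG ] 𝟙 (S x) * 𝟙 (S (x -G (t , w)))
        ≡⟨ ∑-cartesianProduct (allFin m) elems _ ⟩
      ∑[ a ∈ allFin m ] ∑[ u ∈ elems ] 𝟙 (S (a , u)) * 𝟙 (S (a -ₘ t , u ⊝ w))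
        ≡⟨ ∑-cong (λ a → ∑-cong (λ u → cong₂ (λ b c → 𝟙 b * 𝟙 c) (S-layered a u)
             (trans (S-layered _ _) (cong (λ e → part e (u ⊝ w)) (odd-ₘ a t)))) elems) (allFin m) ⟩
      ∑[ a ∈ allFin m ] ∑[ u ∈ elems ] 𝟙 (part (odd (toℕ a)) u) * 𝟙 (part (odd (toℕ a) xor o) (u ⊝ w))
        ≡⟨ ∑-cong (λ a → convolution-⊝-comm (part (odd (toℕ a))) (part-isSubgroup _) w) (allFin m) ⟩
      ∑[ a ∈ allFin m ] convolution (part (odd (toℕ a))) (part (odd (toℕ a) xor o)) w
        ≡⟨ ∑-allFin-parity n (λ e → convolution (part e) (part (e xor o)) w) ⟩
      n * (convolution A (part o) w + convolution B (part (not o)) w)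
        ≡⟨ cong (n *_) (convolution-column o w) ⟩
      n * δ/n o w
        ∎
      where
      open ≡-Reasoning
      o = odd (toℕ t)

    -- the part of Δ S (t , w) coming from the layers of parity e, where o is the parity of t
    layer-sum : Bool → Bool → Carrier → ℕ
    layer-sum o e w = ∑[ u ∈ elems ] 𝟙 (part e u) * (n * δ/n (o xor e) (w ⊝ u))

    layer-sum-same : ∀ o w → layer-sum o o w ≡ n * p * (p * 𝟙 (part o w) + 1)
    layer-sum-same o w = begin
      ∑[ u ∈ elems ] 𝟙 (part o u) * (n * δ/n (o xor o) (w ⊝ u))
        ≡⟨ ∑-cong (λ u → trans (cong (λ e → 𝟙 (part o u) * (n * δ/n e (w ⊝ u))) (xor-same o))
                               (distribute n p (𝟙 (part o u)) (𝟙 (A (w ⊝ u))) (𝟙 (B (w ⊝ u))))) elems ⟩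
      ∑[ u ∈ elems ] n * p * (𝟙 (part o u) * 𝟙 (A (w ⊝ u)) + 𝟙 (part o u) * 𝟙 (B (w ⊝ u)))
        ≡⟨ ∑-*ˡ (n * p) elems _ ⟩
      n * p * (∑[ u ∈ elems ] 𝟙 (part o u) * 𝟙 (A (w ⊝ u)) + 𝟙 (part o u) * 𝟙 (B (w ⊝ u)))
        ≡⟨ cong (n * p *_) (trans (∑-+ elems _ _) (convolution-row o w)) ⟩
      n * p * (p * 𝟙 (part o w) + 1)
        ∎
      where
      open ≡-Reasoning
      distribute : ∀ n p x a b → x * (n * (p * a + p * b)) ≡ n * p * (x * a + x * b)
      distribute = solve-∀

    layer-sum-other : ∀ o w → layer-sum o (not o) w ≡ p * (n * 2)
    layer-sum-other o w = begin
      ∑[ u ∈ elems ] 𝟙 (part (not o) u) * (n * δ/n (o xor not o) (w ⊝ u))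
        ≡⟨ ∑-cong (λ u → cong (λ e → 𝟙 (part (not o) u) * (n * δ/n e (w ⊝ u))) (x-xor-not-x o)) elems ⟩
      ∑[ u ∈ elems ] 𝟙 (part (not o) u) * (n * 2)
        ≡⟨ ∑-*ʳ (n * 2) elems _ ⟩
      size (part (not o)) * (n * 2)
        ≡⟨ cong (_* (n * 2)) (size-part (not o)) ⟩
      p * (n * 2)
        ∎
      where
      open ≡-Reasoning
      x-xor-not-x : ∀ x → x xor not x ≡ true
      x-xor-not-x false = refl
      x-xor-not-x true  = refl

    Δ-S : ∀ t w → Δ S (t , w) ≡ n * n * p * (p * 𝟙 (S (t , w)) + 3)
    Δ-S t w = begin
      Δ S (t , w)
        ≡⟨ ∑-filterᵇ S elemsG _ ⟩
      ∑[ y ∈ elemsG ] 𝟙 (S y) * δ S ((t , w) -G y)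
        ≡⟨ ∑-cartesianProduct (allFin m) elems _ ⟩
      ∑[ s ∈ allFin m ] ∑[ u ∈ elems ] 𝟙 (S (s , u)) * δ S (t -ₘ s , w ⊝ u)
        ≡⟨ ∑-cong (λ s → ∑-cong (λ u → cong₂ (λ b c → 𝟙 b * c) (S-layered s u)
             (trans (δ-S (t -ₘ s) (w ⊝ u)) (cong (λ e → n * δ/n e (w ⊝ u)) (odd-ₘ t s)))) elems) (allFin m) ⟩
      ∑[ s ∈ allFin m ] layer-sum o (odd (toℕ s)) w
        ≡⟨ ∑-allFin-parity n (λ e → layer-sum o e w) ⟩
      n * (layer-sum o false w + layer-sum o true w)
        ≡⟨ cong (n *_) (both-parities o (λ e → layer-sum o e w)) ⟩
      n * (layer-sum o o w + layer-sum o (not o) w)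
        ≡⟨ cong (n *_) (cong₂ _+_ (layer-sum-same o w) (layer-sum-other o w)) ⟩
      n * (n * p * (p * 𝟙 (part o w) + 1) + p * (n * 2))
        ≡⟨ collect n p (𝟙 (part o w)) ⟩
      n * n * p * (p * 𝟙 (part o w) + 3)
        ≡⟨ cong (λ b → n * n * p * (p * 𝟙 b + 3)) (S-layered t w) ⟨
      n * n * p * (p * 𝟙 (S (t , w)) + 3)
        ∎
      where
      open ≡-Reasoning
      o = odd (toℕ t)
      both-parities : ∀ o (f : Bool → ℕ) → f false + f true ≡ f o + f (not o)
      both-parities false f = refl
      both-parities true  f = ℕ.+-comm (f false) (f true)
      collect : ∀ n p c → n * (n * p * (p * c + 1) + p * (n * 2)) ≡ n * n * p * (p * c + 3)
      collect = solve-∀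

    |elemsG|≡m*p^2 : length elemsG ≡ m * p ^ 2
    |elemsG|≡m*p^2 = trans (length-cartesianProduct (allFin m) elems)
                           (cong₂ _*_ (length-tabulate {n = m} (λ i → i)) (trans order≡p*p (sym p^2≡p*p)))
      where p^2≡p*p = cong (p *_) (ℕ.*-identityʳ p)

    count-S : count S elemsG ≡ m * p
    count-S = begin
      count S elemsG                                   ≡⟨ count≡∑𝟙 S elemsG ⟩
      ∑[ x ∈ elemsG ] 𝟙 (S x)                          ≡⟨ ∑-cartesianProduct (allFin m) elems _ ⟩
      ∑[ a ∈ allFin m ] ∑[ u ∈ elems ] 𝟙 (S (a , u))   ≡⟨ ∑-cong (λ a → ∑-cong (cong 𝟙 ∘ S-layered a) elems) (allFin m) ⟩
      ∑[ a ∈ allFin m ] size (part (odd (toℕ a)))      ≡⟨ ∑-allFin-parity n (size ∘ part) ⟩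
      n * (size A + size B)                            ≡⟨ cong (n *_) (cong₂ _+_ size-A size-B) ⟩
      n * (p + p)                                      ≡⟨ n*[p+p]≡n*2*p n p ⟩
      m * p                                            ∎
      where
      open ≡-Reasoning
      n*[p+p]≡n*2*p : ∀ n p → n * (p + p) ≡ n * 2 * p
      n*[p+p]≡n*2*p = solve-∀

    m*p<m*p^2 : m * p < m * p ^ 2
    m*p<m*p^2 = ℕ.*-monoʳ-< m (subst (p <_) (cong (p *_) (sym (ℕ.*-identityʳ p))) (ℕ.m<m*n p p 1<p))

    2<m*p : 2 < m * p
    2<m*p = ℕ.<-≤-trans (s≤s (s≤s (s≤s z≤n))) (ℕ.*-mono-≤ {2} {m} {2} {p} (ℕ.*-monoˡ-≤ 2 (>-nonZero⁻¹ n)) 1<p)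

    Δ-S-inside : ∀ x → S x ≡ true → Δ S x ≡ (m / 2) ^ 2 * (p * (p + 3))
    Δ-S-inside (t , w) t,w∈S = begin
      Δ S (t , w)                            ≡⟨ Δ-S t w ⟩
      n * n * p * (p * 𝟙 (S (t , w)) + 3)    ≡⟨ cong (λ b → n * n * p * (p * 𝟙 b + 3)) t,w∈S ⟩
      n * n * p * (p * 1 + 3)                ≡⟨ rearrange n p ⟩
      n ^ 2 * (p * (p + 3))                  ≡⟨ cong (λ k → k ^ 2 * (p * (p + 3))) (m*n/n≡m n 2) ⟨
      (m / 2) ^ 2 * (p * (p + 3))            ∎
      where
      open ≡-Reasoning
      rearrange : ∀ n p → n * n * p * (p * 1 + 3) ≡ n * (n * 1) * (p * (p + 3))
      rearrange = solve-∀

    Δ-S-outside : ∀ x → S x ≡ false → Δ S x ≡ (3 * m ^ 2 * p) / 4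
    Δ-S-outside (t , w) t,w∉S = begin
      Δ S (t , w)                            ≡⟨ Δ-S t w ⟩
      n * n * p * (p * 𝟙 (S (t , w)) + 3)    ≡⟨ cong (λ b → n * n * p * (p * 𝟙 b + 3)) t,w∉S ⟩
      n * n * p * (p * 0 + 3)                ≡⟨ m*n/n≡m _ 4 ⟨
      n * n * p * (p * 0 + 3) * 4 / 4        ≡⟨ cong (_/ 4) (rearrange n p) ⟩
      (3 * m ^ 2 * p) / 4                    ∎
      where
      open ≡-Reasoning
      rearrange : ∀ n p → n * n * p * (p * 0 + 3) * 4 ≡ 3 * (n * 2 * (n * 2 * 1)) * p
      rearrange = solve-∀

    isPGDS : IsPartialGeometricDifferenceSet S (m * p ^ 2) (m * p) ((m / 2) ^ 2 * (p * (p + 3))) ((3 * m ^ 2 * p) / 4)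
    isPGDS = |elemsG|≡m*p^2 , count-S , m*p<m*p^2 , 2<m*p , Δ-S-inside , Δ-S-outside

theorem3p3 : (p : ℕ) → Prime p →
    (F : FiniteField) → FiniteField.order F ≡ p ^ 2 →
    (γ : FiniteField.Carrier F) → FiniteField.IsPrimitive F γ →
    (i' j' : ℕ) → i' ≤ p → j' ≤ p → i' ≢ j' →
    (m : ℕ) .{{_ : NonZero m}} → 2 ∣ m →
    Construction.IsPartialGeometricDifferenceSet F m
      (Construction.S₂ F m p γ i' j')
      (m * p ^ 2) (m * p) ((m / 2) ^ 2 * (p * (p + 3))) ((3 * m ^ 2 * p) / 4)
theorem3p3 p p-prime F order≡p² γ γ-primitive i' j' i'≤p j'≤p i'≢j' .(n * 2) (divides n refl) =
  isPGDS
  where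
  open FiniteField F using (order)
  order≡p*p : order ≡ p * p
  order≡p*p = trans order≡p² (cong (p *_) (ℕ.*-identityʳ p))
  open CyclotomicClasses F p-prime order≡p*p γ-primitive
  open Construction F (n * 2) using (S₂)
  open ConstructionProperties F n
  open Layered 1<p order≡p*p (S-isSubgroup i') (S-isSubgroup j') (size-S i') (size-S j')
                 (S-disjoint i'≤p j'≤p i'≢j') (S₂ p γ i' j') (layered-by-parity (S i') (S j'))
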